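{- Let $G$ be a directed graph and $v$ a vertex of $G$; let $E(v)$ be the set of edges incident at $v$ and $A(v)=\mathbb{Z}[E(v)]/\mathrm{ann}_{\mathbb{Z}[E(v)]}\mathscr H_0(G)$, a graded $\mathbb{Z}[E(v)]$-module. 1. There are no undirected cycles in $G$ containing $v$ if and only if $A(v)\cong\mathbb{Z}$ as graded $\mathbb{Z}[E(v)]$-modules, where $\mathbb{Z}$ denotes $\mathbb{Z}[E(v)]/(E(v))$ and $(E(v))$ is the ideal generated by $E(v)$. 2. There is an undirected cycle in $G$ containing $v$ if and only if $A_1(v)\ne0$, where $A_1(v)$ is the homogeneous component of $A(v)$ of degree $1$. 3. $\alpha_{undirected}(G,v)\le\operatorname{rank}_{\mathbb{Z}}A_1(v)\le\beta_{undirected}(G,v)$.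
   Context: A directed graph $G$: finite sets $V(G)$, $E(G)$, each edge with an initial and a terminal vertex; loops and multiple edges allowed; no vertex of degree $0$. An undirected cycle is a sequence $v_0,x_0,v_1,\dots,v_n,x_n,v_0$ with $v_0,\dots,v_n$ pairwise distinct and each $x_i$ an edge joining $v_i$ and $v_{i+1}$ in either direction. $\alpha_{undirected}(G,v)$ is the maximal number of pairwise edge-disjoint undirected cycles each containing $v$; $\beta_{undirected}(G,v)$ is the minimal number of edges incident at $v$ whose removal destroys all undirected cycles containing $v$. $\mathbb{Z}[E(G)]$ is graded with edges of degree $1$. For a vertex $w$ with outgoing edges $x_1,\dots,x_m$ and incoming edges $y_1,\dots,y_n$ (loops in both lists), $k_w=\max\{m,n\}$, $\delta_{w,l}=e_l(x_1,\dots,x_m)-e_l(y_1,\dots,y_n)$, $1\le l\le k_w$ ($e_l$ elementary symmetric); $\Delta_G$ lists all these. For homogeneous $r$ in a graded commutative ring $R$, $C^R(r)$ is $0\to R\{\deg r\}\xrightarrow{r}R\to0$ (homological degrees $1,0$) and $C^R(r_1,\dots,r_k)=\bigotimes_R C^R(r_i)$. $\mathscr H_0(G)$ is the $0$-th homology of $C^{\mathbb{Z}[E(G)]}_*(\Delta_G)$, a graded $\mathbb{Z}[E(G)]$-module; $\mathrm{ann}$ denotes the annihilator in the subring $\mathbb{Z}[E(v)]$. -}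

module Defs where

open import Data.Nat using (ℕ; zero; suc; _⊔_; _≤_)
open import Data.Nat.Properties using (suc-injective)
import Data.Nat as ℕ
import Data.Nat.ListAction
open import Data.Integer using (ℤ; 0ℤ; 1ℤ; _+_; _*_; -_)
open import Data.Fin using (Fin; toℕ; lower₁) renaming (zero to fzero; _≟_ to _≟F_)
open import Data.Vec using (Vec; zipWith; tabulate; lookup; toList)
import Data.Vec as Vec
open import Data.Vec.Properties using (≡-dec)
open import Data.List using (List; []; _∷_; _++_; map; concatMap; foldr; filter; allFin; length; upTo)
open import Data.List.Relation.Unary.All using (All)
open import Data.List.Membership.Propositional using (_∈_)
open import Data.Product using (Σ; ∃; _×_; _,_; proj₁)
open import Data.Sum using (_⊎_)
open import Data.Bool using (if_then_else_)
open import Relation.Nullary using (¬_; yes; no; does)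
open import Relation.Nullary.Decidable using (_⊎-dec_)
open import Relation.Binary.PropositionalEquality using (_≡_; _≢_; refl; sym)

-- Directed graphs: vertices Fin nV, edges Fin nE, loops / multi-edges
-- allowed, no vertex of degree 0.

record Digraph : Set where
  field
    nV nE      : ℕ
    src tgt    : Fin nE → Fin nV
    noIsolated : ∀ w → ∃ λ e → src e ≡ w ⊎ tgt e ≡ w
open Digraph public

-- Integer polynomials in n variables  ℤ[x₀,…,x_{n-1}]
-- A polynomial is a finite formal sum of terms (coefficient, exponent
-- vector); two polynomials are equal iff all coefficients agree.

Mono : ℕ → Set
Mono n = Vec ℕ n

Poly : ℕ → Set
Poly n = List (ℤ × Mono n)

module _ {n : ℕ} where

  coeff : Poly n → Mono n → ℤ
  coeff [] m = 0ℤ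
  coeff ((c , m′) ∷ p) m with ≡-dec ℕ._≟_ m′ m
  ... | yes _ = c + coeff p m
  ... | no  _ = coeff p m

  infix 4 _≈P_
  _≈P_ : Poly n → Poly n → Set
  p ≈P q = ∀ m → coeff p m ≡ coeff q m

  0P : Poly n
  0P = []

  constP : ℤ → Poly n
  constP c = (c , Vec.replicate n 0) ∷ []

  1P : Poly n
  1P = constP 1ℤ

  infixl 6 _+P_ _-P_
  infixl 7 _*P_

  _+P_ : Poly n → Poly n → Poly n
  p +P q = p ++ q

  -P_ : Poly n → Poly n
  -P p = map (λ { (c , m) → (- c , m) }) p

  _-P_ : Poly n → Poly n → Poly n
  p -P q = p +P (-P q)

  _*P_ : Poly n → Poly n → Poly n
  p *P q = concatMap (λ { (c , m) → map (λ { (d , m′) → (c * d , zipWith ℕ._+_ m m′) }) q }) p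

  var : Fin n → Poly n
  var i = (1ℤ , tabulate (λ j → if does (i ≟F j) then 1 else 0)) ∷ []

  sumP : List (Poly n) → Poly n
  sumP = foldr _+P_ 0P

  -- total degree of a monomial (every variable has degree 1)
  degM : Mono n → ℕ
  degM m = Data.Nat.ListAction.sum (toList m)

  Homog : ℕ → Poly n → Set
  Homog d p = ∀ m → coeff p m ≢ 0ℤ → degM m ≡ d

  InVars : (Fin n → Set) → Poly n → Set
  InVars S p = ∀ m → coeff p m ≢ 0ℤ → ∀ i → ¬ S i → lookup m i ≡ 0

  esym : ℕ → List (Fin n) → Poly n
  esym zero    _        = 1P
  esym (suc l) []       = 0P
  esym (suc l) (x ∷ xs) = esym (suc l) xs +P (var x *P esym l xs)

  -- Koszul complex C(r_1,…,r_k) over R = ℤ[x]: in homological degrees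
  -- 1 → 0 it is ⊕_i R{deg r_i} → R, (c_i) ↦ Σ c_i r_i.
  -- Its 0-th homology is R / image of this differential.
  koszulD1 : (rs : List (Poly n)) → (Fin (length rs) → Poly n) → Poly n
  koszulD1 rs cs = sumP (map (λ i → cs i *P Data.List.lookup rs i) (allFin (length rs)))

  ImD1 : List (Poly n) → Poly n → Set
  ImD1 rs p = ∃ λ cs → p ≈P koszulD1 rs cs

module _ (G : Digraph) where

  EdgePoly : Set
  EdgePoly = Poly (nE G)

  outE inE : Fin (nV G) → List (Fin (nE G))
  outE w = filter (λ e → src G e ≟F w) (allFin (nE G))
  inE  w = filter (λ e → tgt G e ≟F w) (allFin (nE G))

  kw : Fin (nV G) → ℕ
  kw w = length (outE w) ⊔ length (inE w)

  δ : Fin (nV G) → ℕ → EdgePoly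
  δ w l = esym l (outE w) -P esym l (inE w)

  ΔG : List EdgePoly
  ΔG = concatMap (λ w → map (λ l → δ w (suc l)) (upTo (kw w))) (allFin (nV G))

  Inc : Fin (nV G) → Fin (nE G) → Set
  Inc v e = src G e ≡ v ⊎ tgt G e ≡ v

  incE : Fin (nV G) → List (Fin (nE G))
  incE v = filter (λ e → (src G e ≟F v) ⊎-dec (tgt G e ≟F v)) (allFin (nE G))

  -- R = ℤ[E(v)] as a subring of ℤ[E(G)]
  InR : Fin (nV G) → EdgePoly → Set
  InR v = InVars (Inc v)

  -- annihilator of H_0(G) in ℤ[E(v)] : a ∈ ℤ[E(v)] with a·[h] = 0 in
  -- H_0(G) for every h ∈ ℤ[E(G)]
  Ann : Fin (nV G) → EdgePoly → Set
  Ann v a = InR v a × (∀ h → ImD1 ΔG (a *P h))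

  IdealEv : Fin (nV G) → EdgePoly → Set
  IdealEv v p = ∃ λ (c : Fin (nE G) → EdgePoly) →
    (∀ e → InR v (c e)) × (p ≈P sumP (map (λ e → c e *P var e) (incE v)))

  -- Isomorphism of graded R-modules R/J ≅ R/K (J, K homogeneous ideals
  -- of R = ℤ[E(v)], given by membership predicates), presented on
  -- representatives in R.
  record GradedIso (v : Fin (nV G)) (J K : EdgePoly → Set) : Set where
    field
      f       : EdgePoly → EdgePoly
      f-R     : ∀ p → InR v p → InR v (f p)
      f-resp  : ∀ p q → InR v p → InR v q → J (p -P q) → K (f p -P f q)
      f-add   : ∀ p q → InR v p → InR v q → K (f (p +P q) -P (f p +P f q))
      f-lin   : ∀ a p → InR v a → InR v p → K (f (a *P p) -P (a *P f p))
      f-grade : ∀ d p → InR v p → Homog d p →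
                  ∃ λ q → InR v q × Homog d q × K (f p -P q)
      f-inj   : ∀ p q → InR v p → InR v q → K (f p -P f q) → J (p -P q)
      f-surj  : ∀ q → InR v q → ∃ λ p → InR v p × K (f p -P q)

  AIsoZ : Fin (nV G) → Set
  AIsoZ v = GradedIso v (Ann v) (IdealEv v)

  A1NonZero : Fin (nV G) → Set
  A1NonZero v = ∃ λ p → InR v p × Homog 1 p × ¬ Ann v p

  Indep : Fin (nV G) → {k : ℕ} → (Fin k → EdgePoly) → Set
  Indep v {k} ps = ∀ (c : Fin k → ℤ) →
    Ann v (sumP (map (λ i → constP (c i) *P ps i) (allFin k))) → ∀ i → c i ≡ 0ℤ

  InA1 : Fin (nV G) → EdgePoly → Set
  InA1 v p = InR v p × Homog 1 p

  IsRankA1 : Fin (nV G) → ℕ → Set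
  IsRankA1 v r =
    (∃ λ (ps : Fin r → EdgePoly) → (∀ i → InA1 v (ps i)) × Indep v ps) ×
    (∀ (ps : Fin (suc r) → EdgePoly) → (∀ i → InA1 v (ps i)) → ¬ Indep v ps)

  -- Undirected cycles v_0,x_0,v_1,…,v_n,x_n,v_0

  next : ∀ {n} → Fin (suc n) → Fin (suc n)
  next {n} i with toℕ i ℕ.≟ n
  ... | yes _ = fzero
  ... | no ne = lower₁ (Fin.suc i) (λ eq → ne (sym (suc-injective eq)))
    where import Data.Fin as Fin

  Joins : Fin (nE G) → Fin (nV G) → Fin (nV G) → Set
  Joins e a b = (src G e ≡ a × tgt G e ≡ b) ⊎ (src G e ≡ b × tgt G e ≡ a)

  record Cycle : Set where
    field
      len    : ℕ
      vs     : Fin (suc len) → Fin (nV G)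
      xs     : Fin (suc len) → Fin (nE G)
      vs-inj : ∀ i j → vs i ≡ vs j → i ≡ j
      xs-inj : ∀ i j → xs i ≡ xs j → i ≡ j
      joins  : ∀ i → Joins (xs i) (vs i) (vs (next i))

  Through : Fin (nV G) → Cycle → Set
  Through v C = ∃ λ i → Cycle.vs C i ≡ v

  Uses : Cycle → Fin (nE G) → Set
  Uses C e = ∃ λ i → Cycle.xs C i ≡ e

  HasCycleThrough : Fin (nV G) → Set
  HasCycleThrough v = ∃ λ C → Through v C

  αLe : Fin (nV G) → ℕ → Set
  αLe v r = ∀ (k : ℕ) (cs : Fin k → Cycle) → (∀ i → Through v (cs i)) →
    (∀ i j → i ≢ j → ∀ e → ¬ (Uses (cs i) e × Uses (cs j) e)) → k ≤ r

  βGe : Fin (nV G) → ℕ → Set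
  βGe v r = ∀ (S : List (Fin (nE G))) → All (Inc v) S →
    (∀ C → Through v C → ∃ λ e → e ∈ S × Uses C e) → r ≤ length S

-- A circulation f on G (zero net flow at every vertex) gives a ring map ℤ[E(G)] → ℤ[ε]/(ε²),
-- xₑ ↦ f(e) ε, which kills every δ_{w,l}: the linear part of δ_{w,1} is the net flow of f at w,
-- and δ_{w,l} has no linear part for l ≥ 2. A cycle through v carries a circulation that is ±1
-- on its edge at v, so that edge is not in the annihilator, and edge-disjoint cycles give
-- independent classes in A₁(v).
--
-- Conversely, ∑_{w ∈ K} δ_{w,1} is the signed sum of the edges leaving K. If no cycle through v
-- avoids a set S of edges, then for an edge e at v, the set K of vertices joined to v by paths
-- avoiding S and e is crossed by e and otherwise only by edges of S; so xₑ reduces modulo (Δ_G)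
-- to a combination of the edges of S. For S empty this puts E(v), hence (E(v)), into the
-- annihilator; in general it bounds the rank of A₁(v) by |S|.

module Submission where

open import Defs
open import Data.Nat using (ℕ; zero; suc; _≤_; _<_; z≤n; s≤s)
import Data.Nat as ℕ
import Data.Nat.Properties as ℕP
open import Data.Integer using (ℤ; 0ℤ; 1ℤ; _+_; _*_; -_; _-_)
import Data.Integer as ℤ
import Data.Integer.Properties as ℤP
open import Data.Integer.Tactic.RingSolver using (solve-∀)
open import Data.Fin using (Fin; toℕ; inject≤; punchIn; punchOut; lower₁; fromℕ; inject₁)
  renaming (zero to fzero; suc to fsuc; _≟_ to _≟F_)
import Data.Fin.Properties as FP
open import Data.Vec using (zipWith; tabulate; lookup) renaming ([] to []v; _∷_ to _∷v_)
import Data.Vec as Vec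
import Data.Vec.Properties as VP
open import Data.Vec.Properties using (≡-dec)
open import Data.List using (List; []; _∷_; _++_; map; concatMap; concat; allFin; length; filter; deduplicate)
import Data.List as List
import Data.List.Properties as LP
open import Data.List.Relation.Unary.All using (All; []; _∷_)
import Data.List.Relation.Unary.All as All
import Data.List.Relation.Unary.All.Properties as AllP
open import Data.List.Relation.Unary.Any using (here; there)
import Data.List.Relation.Unary.Any as Any
import Data.List.Relation.Unary.Any.Properties as AnyP
open import Data.List.Membership.Propositional using (_∈_; _∉_)
import Data.List.Membership.Propositional.Properties as MemP
import Data.List.Membership.DecPropositional as DecMem
open import Data.List.Relation.Unary.Unique.Propositional using (Unique)
open import Data.List.Relation.Unary.AllPairs using (_∷_)
open import Data.List.Relation.Unary.Unique.DecPropositional.Properties using (deduplicate-!)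
open import Data.Product using (Σ; ∃; _×_; _,_; proj₁; proj₂)
open import Data.Sum using (_⊎_; inj₁; inj₂; [_,_]′; map₂)
open import Data.Empty using (⊥-elim)
open import Data.Bool using (true; false; if_then_else_)
open import Relation.Nullary using (¬_; yes; no; does; Dec; ¬?)
open import Relation.Nullary.Decidable using (_⊎-dec_; _×-dec_; toSum; decidable-stable; dec-true; dec-false)
open import Relation.Binary.PropositionalEquality using (_≡_; _≢_; refl; sym; trans; cong; cong₂; subst; module ≡-Reasoning)
open import Function using (_∘_)
open import Function.Bundles using (_⇔_; mk⇔)

∑ : ∀ {A : Set} → (A → ℤ) → List A → ℤ
∑ f []       = 0ℤ
∑ f (x ∷ xs) = f x + ∑ f xs

module _ {A : Set} where

  ∑-cong : ∀ {f g : A → ℤ} xs → (∀ x → f x ≡ g x) → ∑ f xs ≡ ∑ g xs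
  ∑-cong []       f≗g = refl
  ∑-cong (x ∷ xs) f≗g = cong₂ _+_ (f≗g x) (∑-cong xs f≗g)

  ∑-zero : ∀ {f : A → ℤ} xs → (∀ x → f x ≡ 0ℤ) → ∑ f xs ≡ 0ℤ
  ∑-zero []       f≗0 = refl
  ∑-zero (x ∷ xs) f≗0 = cong₂ _+_ (f≗0 x) (∑-zero xs f≗0)

  ∑-+ : ∀ (f g : A → ℤ) xs → ∑ (λ x → f x + g x) xs ≡ ∑ f xs + ∑ g xs
  ∑-+ f g []       = refl
  ∑-+ f g (x ∷ xs) rewrite ∑-+ f g xs = interchange (f x) (g x) (∑ f xs) (∑ g xs)
    where interchange : ∀ a b c d → a + b + (c + d) ≡ a + c + (b + d)
          interchange = solve-∀

  ∑-*ˡ : ∀ (c : ℤ) (f : A → ℤ) xs → ∑ (λ x → c * f x) xs ≡ c * ∑ f xs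
  ∑-*ˡ c f []       = sym (ℤP.*-zeroʳ c)
  ∑-*ˡ c f (x ∷ xs) rewrite ∑-*ˡ c f xs = sym (ℤP.*-distribˡ-+ c (f x) (∑ f xs))

  ∑-*ʳ : ∀ (c : ℤ) (f : A → ℤ) xs → ∑ (λ x → f x * c) xs ≡ ∑ f xs * c
  ∑-*ʳ c f xs = trans (∑-cong xs (λ x → ℤP.*-comm (f x) c)) (trans (∑-*ˡ c f xs) (ℤP.*-comm c _))

  ∑-neg : ∀ (f : A → ℤ) xs → ∑ (λ x → - f x) xs ≡ - ∑ f xs
  ∑-neg f []       = refl
  ∑-neg f (x ∷ xs) rewrite ∑-neg f xs = sym (ℤP.neg-distrib-+ (f x) (∑ f xs))

  ∑-minus : ∀ (f g : A → ℤ) xs → ∑ (λ x → f x - g x) xs ≡ ∑ f xs - ∑ g xs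
  ∑-minus f g xs = trans (∑-+ f (λ x → - g x) xs) (cong (∑ f xs +_) (∑-neg g xs))

  ∑-++ : ∀ (f : A → ℤ) xs ys → ∑ f (xs ++ ys) ≡ ∑ f xs + ∑ f ys
  ∑-++ f []       ys = sym (ℤP.+-identityˡ _)
  ∑-++ f (x ∷ xs) ys rewrite ∑-++ f xs ys = sym (ℤP.+-assoc (f x) _ _)

  ∑-filter : ∀ {P : A → Set} (P? : ∀ x → Dec (P x)) (f : A → ℤ) xs →
             ∑ f (filter P? xs) ≡ ∑ (λ x → if does (P? x) then f x else 0ℤ) xs
  ∑-filter P? f []       = refl
  ∑-filter P? f (x ∷ xs) with does (P? x)
  ... | true  = cong (f x +_) (∑-filter P? f xs)
  ... | false = trans (∑-filter P? f xs) (sym (ℤP.+-identityˡ _))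

module _ {A B : Set} where

  ∑-map : ∀ (f : B → ℤ) (g : A → B) xs → ∑ f (map g xs) ≡ ∑ (f ∘ g) xs
  ∑-map f g []       = refl
  ∑-map f g (x ∷ xs) = cong (f (g x) +_) (∑-map f g xs)

  ∑-concatMap : ∀ (f : B → ℤ) (g : A → List B) xs → ∑ f (concatMap g xs) ≡ ∑ (λ x → ∑ f (g x)) xs
  ∑-concatMap f g []       = refl
  ∑-concatMap f g (x ∷ xs) = trans (∑-++ f (g x) (concatMap g xs)) (cong (∑ f (g x) +_) (∑-concatMap f g xs))

  ∑-swap : ∀ (F : A → B → ℤ) xs ys → ∑ (λ x → ∑ (F x) ys) xs ≡ ∑ (λ y → ∑ (λ x → F x y) xs) ys
  ∑-swap F []       ys = sym (∑-zero ys (λ _ → refl))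
  ∑-swap F (x ∷ xs) ys rewrite ∑-swap F xs ys = sym (∑-+ (F x) (λ y → ∑ (λ x → F x y) xs) ys)

∑-allFin-suc : ∀ {n} (f : Fin (suc n) → ℤ) → ∑ f (allFin (suc n)) ≡ f fzero + ∑ (f ∘ fsuc) (allFin n)
∑-allFin-suc {n} f =
  cong (f fzero +_) (trans (cong (∑ f) (sym (LP.map-tabulate (λ x → x) fsuc))) (∑-map f fsuc (allFin n)))

∑-punchIn : ∀ {r} (i : Fin (suc r)) (f : Fin (suc r) → ℤ) →
            ∑ f (allFin (suc r)) ≡ f i + ∑ (f ∘ punchIn i) (allFin r)
∑-punchIn         fzero    f = ∑-allFin-suc f
∑-punchIn {suc r} (fsuc i) f =
  trans (∑-allFin-suc f) (trans (cong (f fzero +_) (∑-punchIn i (f ∘ fsuc)))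
    (trans (swap (f fzero) (f (fsuc i)) _) (cong (f (fsuc i) +_) (sym (∑-allFin-suc (f ∘ punchIn (fsuc i)))))))
  where swap : ∀ a b c → a + (b + c) ≡ b + (a + c)
        swap = solve-∀

kronecker : ∀ {n} → Fin n → Fin n → ℤ → ℤ
kronecker i j a = if does (i ≟F j) then a else 0ℤ

∑-kronecker : ∀ {n} (i : Fin n) (g : Fin n → ℤ) → ∑ (λ j → kronecker i j (g j)) (allFin n) ≡ g i
∑-kronecker {suc n} fzero    g = trans (∑-allFin-suc (λ j → kronecker fzero j (g j)))
  (trans (cong (g fzero +_) (∑-zero (allFin n) (λ _ → refl))) (ℤP.+-identityʳ _))
∑-kronecker {suc n} (fsuc i) g = trans (∑-allFin-suc (λ j → kronecker (fsuc i) j (g j)))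
  (trans (ℤP.+-identityˡ _) (∑-kronecker i (g ∘ fsuc)))

*-distribˡ-minus : ∀ x a b → x * (a - b) ≡ x * a - x * b
*-distribˡ-minus = solve-∀

*-distribʳ-minus : ∀ a b x → (a - b) * x ≡ a * x - b * x
*-distribʳ-minus = solve-∀

kronecker-*ˡ : ∀ {n} x (i j : Fin n) a → x * kronecker i j a ≡ kronecker i j (x * a)
kronecker-*ˡ x i j a with does (i ≟F j)
... | true  = refl
... | false = ℤP.*-zeroʳ x

kronecker-1-* : ∀ {n} (i j : Fin n) a → kronecker i j 1ℤ * a ≡ kronecker i j a
kronecker-1-* i j a with does (i ≟F j)
... | true  = ℤP.*-identityˡ a
... | false = ℤP.*-zeroˡ a

does-⇔ : ∀ {P Q : Set} (p : Dec P) (q : Dec Q) → (P → Q) → (Q → P) → does p ≡ does q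
does-⇔ (yes _) (yes _) _   _   = refl
does-⇔ (yes p) (no ¬q) P→Q _   = ⊥-elim (¬q (P→Q p))
does-⇔ (no ¬p) (yes q) _   Q→P = ⊥-elim (¬p (Q→P q))
does-⇔ (no _)  (no _)  _   _   = refl

-- Polynomials through linear functionals

module _ {n : ℕ} where

  infixl 6 _+M_
  _+M_ : Mono n → Mono n → Mono n
  _+M_ = zipWith ℕ._+_

  infix 4 _≟M_
  _≟M_ : (a b : Mono n) → Dec (a ≡ b)
  _≟M_ = ≡-dec ℕ._≟_

  -- A formal sum is determined by the values of all linear extensions ⟪ g ⟫ on it, so
  -- every ring law below is checked through them.
  ⟪_⟫ : (Mono n → ℤ) → Poly n → ℤ
  ⟪ g ⟫ = ∑ (λ t → proj₁ t * g (proj₂ t))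

  atMono : Mono n → Mono n → ℤ
  atMono m m′ = if does (m′ ≟M m) then 1ℤ else 0ℤ

  coeff≡⟪atMono⟫ : ∀ p m → coeff p m ≡ ⟪ atMono m ⟫ p
  coeff≡⟪atMono⟫ []             m = refl
  coeff≡⟪atMono⟫ ((c , m′) ∷ p) m with m′ ≟M m
  ... | yes _ = cong₂ _+_ (sym (ℤP.*-identityʳ c)) (coeff≡⟪atMono⟫ p m)
  ... | no  _ = trans (coeff≡⟪atMono⟫ p m) (sym (trans (cong (_+ ⟪ atMono m ⟫ p) (ℤP.*-zeroʳ c)) (ℤP.+-identityˡ _)))

  ⟪⟫-cong : ∀ {g h : Mono n → ℤ} p → (∀ m → g m ≡ h m) → ⟪ g ⟫ p ≡ ⟪ h ⟫ p
  ⟪⟫-cong p g≗h = ∑-cong p (λ t → cong (proj₁ t *_) (g≗h (proj₂ t)))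

  ⟪⟫-+P : ∀ g p q → ⟪ g ⟫ (p +P q) ≡ ⟪ g ⟫ p + ⟪ g ⟫ q
  ⟪⟫-+P g p q = ∑-++ _ p q

  private
    -P≡map : ∀ (p : Poly n) → -P p ≡ map (λ t → (- proj₁ t , proj₂ t)) p
    -P≡map p = LP.map-cong (λ { (c , m) → refl }) p

  ⟪⟫-negP : ∀ g p → ⟪ g ⟫ (-P p) ≡ - ⟪ g ⟫ p
  ⟪⟫-negP g p rewrite -P≡map p =
    trans (∑-map _ _ p) (trans (∑-cong p (λ t → sym (ℤP.neg-distribˡ-* (proj₁ t) _))) (∑-neg _ p))

  private
    *P≡concatMap : ∀ (p q : Poly n) →
      p *P q ≡ concatMap (λ t → map (λ s → (proj₁ t * proj₁ s , proj₂ t +M proj₂ s)) q) p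
    *P≡concatMap p q = cong concat (LP.map-cong (λ { (c , m) → LP.map-cong (λ { (d , m′) → refl }) q }) p)

  ⟪⟫-*P : ∀ g p q → ⟪ g ⟫ (p *P q) ≡ ⟪ (λ m₁ → ⟪ (λ m₂ → g (m₁ +M m₂)) ⟫ q) ⟫ p
  ⟪⟫-*P g p q rewrite *P≡concatMap p q =
    trans (∑-concatMap _ _ p) (∑-cong p (λ t →
      trans (∑-map _ _ q) (trans (∑-cong q (λ s → ℤP.*-assoc (proj₁ t) (proj₁ s) _)) (∑-*ˡ (proj₁ t) _ q))))

  ⟪⟫-sumP : ∀ g (ps : List (Poly n)) → ⟪ g ⟫ (sumP ps) ≡ ∑ ⟪ g ⟫ ps
  ⟪⟫-sumP g []       = refl
  ⟪⟫-sumP g (p ∷ ps) = trans (⟪⟫-+P g p (sumP ps)) (cong (⟪ g ⟫ p +_) (⟪⟫-sumP g ps))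

  ⟪⟫-scaleˡ : ∀ c (h : Mono n → ℤ) p → ⟪ (λ m → c * h m) ⟫ p ≡ c * ⟪ h ⟫ p
  ⟪⟫-scaleˡ c h p = trans (∑-cong p (λ t → swap (proj₁ t) c (h (proj₂ t)))) (∑-*ˡ c _ p)
    where swap : ∀ a b x → a * (b * x) ≡ b * (a * x)
          swap = solve-∀

  ⟪⟫-scaleʳ : ∀ c (h : Mono n → ℤ) p → ⟪ (λ m → h m * c) ⟫ p ≡ ⟪ h ⟫ p * c
  ⟪⟫-scaleʳ c h p = trans (⟪⟫-cong p (λ m → ℤP.*-comm (h m) c)) (trans (⟪⟫-scaleˡ c h p) (ℤP.*-comm c _))

  ⟪⟫-+fn : ∀ (h k : Mono n → ℤ) p → ⟪ (λ m → h m + k m) ⟫ p ≡ ⟪ h ⟫ p + ⟪ k ⟫ p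
  ⟪⟫-+fn h k p = trans (∑-cong p (λ t → ℤP.*-distribˡ-+ (proj₁ t) (h (proj₂ t)) (k (proj₂ t)))) (∑-+ _ _ p)

  ⟪⟫-∑fn : ∀ {A : Set} (F : A → Mono n → ℤ) xs p → ⟪ (λ m → ∑ (λ a → F a m) xs) ⟫ p ≡ ∑ (λ a → ⟪ F a ⟫ p) xs
  ⟪⟫-∑fn F xs p = trans (∑-cong p (λ t → sym (∑-*ˡ (proj₁ t) (λ a → F a (proj₂ t)) xs)))
                        (∑-swap (λ t a → proj₁ t * F a (proj₂ t)) p xs)

  private
    picked : Mono n → ℤ → Mono n → ℤ
    picked m₀ c m = if does (m₀ ≟M m) then c else 0ℤ

    coeff-∷ : ∀ c m₀ p m → coeff ((c , m₀) ∷ p) m ≡ picked m₀ c m + coeff p m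
    coeff-∷ c m₀ p m with m₀ ≟M m
    ... | yes _ = refl
    ... | no  _ = sym (ℤP.+-identityˡ _)

    ∑-picked-∉ : ∀ c (g : Mono n → ℤ) m₀ {M} → All (m₀ ≢_) M → ∑ (λ m → picked m₀ c m * g m) M ≡ 0ℤ
    ∑-picked-∉ c g m₀ []                 = refl
    ∑-picked-∉ c g m₀ {m ∷ M} (m₀≢m ∷ ≢M) with m₀ ≟M m
    ... | yes m₀≡m = ⊥-elim (m₀≢m m₀≡m)
    ... | no  _    = cong₂ _+_ (ℤP.*-zeroˡ (g m)) (∑-picked-∉ c g m₀ ≢M)

    ∑-picked-∈ : ∀ c (g : Mono n → ℤ) m₀ {M} → Unique M → m₀ ∈ M → ∑ (λ m → picked m₀ c m * g m) M ≡ c * g m₀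
    ∑-picked-∈ c g m₀ (≢M ∷ _) (here refl) with m₀ ≟M m₀
    ... | yes _  = trans (cong (c * g m₀ +_) (∑-picked-∉ c g m₀ ≢M)) (ℤP.+-identityʳ _)
    ... | no  ≢ = ⊥-elim (≢ refl)
    ∑-picked-∈ c g m₀ {m ∷ M} (≢M ∷ u) (there m₀∈) with m₀ ≟M m
    ... | yes refl = ⊥-elim (All.lookup ≢M m₀∈ refl)
    ... | no  _    = trans (cong₂ _+_ (ℤP.*-zeroˡ (g m)) (∑-picked-∈ c g m₀ u m₀∈)) (ℤP.+-identityˡ _)

  ⟪⟫-on-support : ∀ (g : Mono n → ℤ) M p → Unique M → (∀ {t} → t ∈ p → proj₂ t ∈ M) →
                  ⟪ g ⟫ p ≡ ∑ (λ m → coeff p m * g m) M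
  ⟪⟫-on-support g M []             u sub = sym (∑-zero M (λ m → ℤP.*-zeroˡ (g m)))
  ⟪⟫-on-support g M ((c , m₀) ∷ p) u sub = begin
    c * g m₀ + ⟪ g ⟫ p
      ≡⟨ cong₂ _+_ (sym (∑-picked-∈ c g m₀ u (sub (here refl)))) (⟪⟫-on-support g M p u (sub ∘ there)) ⟩
    ∑ (λ m → picked m₀ c m * g m) M + ∑ (λ m → coeff p m * g m) M
      ≡⟨ sym (∑-+ _ _ M) ⟩
    ∑ (λ m → picked m₀ c m * g m + coeff p m * g m) M
      ≡⟨ ∑-cong M (λ m → trans (sym (ℤP.*-distribʳ-+ (g m) (picked m₀ c m) (coeff p m))) (cong (_* g m) (sym (coeff-∷ c m₀ p m)))) ⟩
    ∑ (λ m → coeff ((c , m₀) ∷ p) m * g m) M ∎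
    where open ≡-Reasoning

  private
    support : Poly n → List (Mono n)
    support p = deduplicate _≟M_ (map proj₂ p)

    support-unique : ∀ p → Unique (support p)
    support-unique p = deduplicate-! _≟M_ (map proj₂ p)

  ⟪⟫-resp-≈P : ∀ (g : Mono n → ℤ) {p q} → p ≈P q → ⟪ g ⟫ p ≡ ⟪ g ⟫ q
  ⟪⟫-resp-≈P g {p} {q} p≈q = begin
    ⟪ g ⟫ p                       ≡⟨ ⟪⟫-on-support g M p (support-unique (p ++ q)) (λ t∈ → covers (MemP.∈-++⁺ˡ (MemP.∈-map⁺ proj₂ t∈))) ⟩
    ∑ (λ m → coeff p m * g m) M   ≡⟨ ∑-cong M (λ m → cong (_* g m) (p≈q m)) ⟩
    ∑ (λ m → coeff q m * g m) M   ≡⟨ sym (⟪⟫-on-support g M q (support-unique (p ++ q)) (λ t∈ → covers (MemP.∈-++⁺ʳ (map proj₂ p) (MemP.∈-map⁺ proj₂ t∈)))) ⟩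
    ⟪ g ⟫ q                       ∎
    where
    open ≡-Reasoning
    M = support (p ++ q)
    covers : ∀ {m} → m ∈ map proj₂ p ++ map proj₂ q → m ∈ M
    covers m∈ = MemP.∈-deduplicate⁺ _≟M_ (subst (_ ∈_) (sym (LP.map-++ proj₂ p q)) m∈)

  ⟪⟫-vanish : ∀ (g : Mono n → ℤ) p → (∀ m → coeff p m ≢ 0ℤ → g m ≡ 0ℤ) → ⟪ g ⟫ p ≡ 0ℤ
  ⟪⟫-vanish g p g-off-support =
    trans (⟪⟫-on-support g (support p) p (support-unique p) (λ t∈ → MemP.∈-deduplicate⁺ _≟M_ (MemP.∈-map⁺ proj₂ t∈)))
          (∑-zero (support p) term≡0)
    where
    term≡0 : ∀ m → coeff p m * g m ≡ 0ℤ
    term≡0 m with coeff p m ℤ.≟ 0ℤ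
    ... | yes c≡0 = trans (cong (_* g m) c≡0) (ℤP.*-zeroˡ (g m))
    ... | no  c≢0 = trans (cong (coeff p m *_) (g-off-support m c≢0)) (ℤP.*-zeroʳ (coeff p m))

-- _≈P_ wrapped in a record so that both polynomials can be inferred.
infix 4 _≋_
record _≋_ {n : ℕ} (p q : Poly n) : Set where
  constructor mk≋
  field coeff-≡ : p ≈P q
open _≋_ public

module _ {n : ℕ} where

  ≋-ext : {p q : Poly n} → (∀ g → ⟪ g ⟫ p ≡ ⟪ g ⟫ q) → p ≋ q
  ≋-ext {p} {q} ⟪⟫p≡⟪⟫q = mk≋ (λ m → trans (coeff≡⟪atMono⟫ p m) (trans (⟪⟫p≡⟪⟫q (atMono m)) (sym (coeff≡⟪atMono⟫ q m))))

  ⟪⟫-resp-≋ : ∀ (g : Mono n → ℤ) {p q : Poly n} → p ≋ q → ⟪ g ⟫ p ≡ ⟪ g ⟫ q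
  ⟪⟫-resp-≋ g {p} {q} (mk≋ p≈q) = ⟪⟫-resp-≈P g {p} {q} p≈q

  ≋-sym : {p q : Poly n} → p ≋ q → q ≋ p
  ≋-sym (mk≋ p≈q) = mk≋ (λ m → sym (p≈q m))

  ≋-trans : {p q r : Poly n} → p ≋ q → q ≋ r → p ≋ r
  ≋-trans (mk≋ p≈q) (mk≋ q≈r) = mk≋ (λ m → trans (p≈q m) (q≈r m))

  ⟪⟫-minusP : ∀ (g : Mono n → ℤ) p q → ⟪ g ⟫ (p -P q) ≡ ⟪ g ⟫ p - ⟪ g ⟫ q
  ⟪⟫-minusP g p q = trans (⟪⟫-+P g p (-P q)) (cong (⟪ g ⟫ p +_) (⟪⟫-negP g q))

  private
    +M-comm : (a b : Mono n) → a +M b ≡ b +M a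
    +M-comm = VP.zipWith-comm ℕP.+-comm

    +M-assoc : (a b c : Mono n) → (a +M b) +M c ≡ a +M (b +M c)
    +M-assoc = VP.zipWith-assoc ℕP.+-assoc

    +M-identityˡ : (a : Mono n) → Vec.replicate n 0 +M a ≡ a
    +M-identityˡ = VP.zipWith-identityˡ ℕP.+-identityˡ

  ⟪⟫-constP* : ∀ (g : Mono n → ℤ) c p → ⟪ g ⟫ (constP c *P p) ≡ c * ⟪ g ⟫ p
  ⟪⟫-constP* g c p =
    trans (⟪⟫-*P g (constP c) p) (trans (ℤP.+-identityʳ _) (cong (c *_) (⟪⟫-cong p (λ m → cong g (+M-identityˡ m)))))

  *P-congʳ : (p : Poly n) {q q′ : Poly n} → q ≋ q′ → p *P q ≋ p *P q′
  *P-congʳ p {q} {q′} q≋q′ = ≋-ext (λ g →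
    trans (⟪⟫-*P g p q) (trans (⟪⟫-cong p (λ m₁ → ⟪⟫-resp-≋ (λ m₂ → g (m₁ +M m₂)) q≋q′)) (sym (⟪⟫-*P g p q′))))

  *P-comm : (p q : Poly n) → p *P q ≋ q *P p
  *P-comm p q = ≋-ext (λ g → begin
    ⟪ g ⟫ (p *P q)
      ≡⟨ ⟪⟫-*P g p q ⟩
    ∑ (λ t → proj₁ t * ∑ (λ s → proj₁ s * g (proj₂ t +M proj₂ s)) q) p
      ≡⟨ ∑-cong p (λ t → sym (∑-*ˡ (proj₁ t) _ q)) ⟩
    ∑ (λ t → ∑ (λ s → proj₁ t * (proj₁ s * g (proj₂ t +M proj₂ s))) q) p
      ≡⟨ ∑-swap _ p q ⟩
    ∑ (λ s → ∑ (λ t → proj₁ t * (proj₁ s * g (proj₂ t +M proj₂ s))) p) q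
      ≡⟨ ∑-cong q (λ s → ∑-cong p (λ t → trans (swap (proj₁ t) (proj₁ s) _) (cong (λ m → proj₁ s * (proj₁ t * g m)) (+M-comm (proj₂ t) (proj₂ s))))) ⟩
    ∑ (λ s → ∑ (λ t → proj₁ s * (proj₁ t * g (proj₂ s +M proj₂ t))) p) q
      ≡⟨ ∑-cong q (λ s → ∑-*ˡ (proj₁ s) _ p) ⟩
    ∑ (λ s → proj₁ s * ∑ (λ t → proj₁ t * g (proj₂ s +M proj₂ t)) p) q
      ≡⟨ sym (⟪⟫-*P g q p) ⟩
    ⟪ g ⟫ (q *P p) ∎)
    where open ≡-Reasoning
          swap : ∀ a b x → a * (b * x) ≡ b * (a * x)
          swap = solve-∀

  *P-assoc : (p q r : Poly n) → (p *P q) *P r ≋ p *P (q *P r)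
  *P-assoc p q r = ≋-ext (λ g →
    trans (⟪⟫-*P g (p *P q) r) (trans (⟪⟫-*P _ p q)
      (trans (⟪⟫-cong p (λ m₁ → ⟪⟫-cong q (λ m₂ → ⟪⟫-cong r (λ m₃ → cong g (+M-assoc m₁ m₂ m₃)))))
        (sym (trans (⟪⟫-*P g p (q *P r)) (⟪⟫-cong p (λ m₁ → ⟪⟫-*P (λ m₂₃ → g (m₁ +M m₂₃)) q r)))))))

  *P-distribʳ : (p q h : Poly n) → (p +P q) *P h ≋ (p *P h) +P (q *P h)
  *P-distribʳ p q h = ≋-ext (λ g →
    trans (⟪⟫-*P g (p +P q) h) (trans (⟪⟫-+P _ p q)
      (sym (trans (⟪⟫-+P g (p *P h) (q *P h)) (cong₂ _+_ (⟪⟫-*P g p h) (⟪⟫-*P g q h))))))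

  -P-*P : (p q : Poly n) → (-P p) *P q ≋ -P (p *P q)
  -P-*P p q = ≋-ext (λ g →
    trans (⟪⟫-*P g (-P p) q) (trans (⟪⟫-negP _ p) (sym (trans (⟪⟫-negP g (p *P q)) (cong -_ (⟪⟫-*P g p q))))))

  -P-self : (p : Poly n) → p -P p ≋ 0P
  -P-self p = ≋-ext (λ g → trans (⟪⟫-minusP g p p) (ℤP.+-inverseʳ (⟪ g ⟫ p)))

  *P-identityʳ : (p : Poly n) → p *P 1P ≋ p
  *P-identityʳ p = ≋-ext (λ g → trans (⟪⟫-*P g p 1P) (⟪⟫-cong p (λ m →
    trans (ℤP.+-identityʳ _) (trans (ℤP.*-identityˡ _) (cong g (trans (+M-comm m _) (+M-identityˡ m)))))))

  *P-identityˡ : (p : Poly n) → 1P *P p ≋ p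
  *P-identityˡ p = ≋-trans (*P-comm 1P p) (*P-identityʳ p)

-- ImD1 rs p says p = ∑ᵢ cᵢ rᵢ, i.e. p lies in the ideal generated by rs; the record
-- makes p inferable.
infix 4 _∈⟨_⟩
record _∈⟨_⟩ {n : ℕ} (p : Poly n) (rs : List (Poly n)) : Set where
  constructor mk∈⟨⟩
  field membership : ImD1 rs p

module _ {n : ℕ} {rs : List (Poly n)} where

  private
    k = length rs

    term : (Fin k → Poly n) → Fin k → Poly n
    term cs i = cs i *P List.lookup rs i

    ⟪⟫-koszulD1 : ∀ (g : Mono n → ℤ) cs → ⟪ g ⟫ (koszulD1 rs cs) ≡ ∑ (⟪ g ⟫ ∘ term cs) (allFin k)
    ⟪⟫-koszulD1 g cs = trans (⟪⟫-sumP g (map (term cs) (allFin k))) (∑-map ⟪ g ⟫ (term cs) (allFin k))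

    ∈⟨⟩-by : ∀ {p} cs → (∀ g → ⟪ g ⟫ p ≡ ∑ (⟪ g ⟫ ∘ term cs) (allFin k)) → p ∈⟨ rs ⟩
    ∈⟨⟩-by {p} cs ⟪⟫p = mk∈⟨⟩ (cs , coeff-≡ (≋-ext {p = p} {q = koszulD1 rs cs} (λ g → trans (⟪⟫p g) (sym (⟪⟫-koszulD1 g cs)))))

    ∈⟨⟩-⟪⟫ : ∀ {p} → p ∈⟨ rs ⟩ → ∃ λ cs → ∀ g → ⟪ g ⟫ p ≡ ∑ (⟪ g ⟫ ∘ term cs) (allFin k)
    ∈⟨⟩-⟪⟫ {p} (mk∈⟨⟩ (cs , p≈)) = cs , λ g → trans (⟪⟫-resp-≈P g {p} {koszulD1 rs cs} p≈) (⟪⟫-koszulD1 g cs)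

  ∈⟨⟩-resp-≋ : ∀ {p q} → p ≋ q → q ∈⟨ rs ⟩ → p ∈⟨ rs ⟩
  ∈⟨⟩-resp-≋ (mk≋ p≈q) (mk∈⟨⟩ (cs , q≈)) = mk∈⟨⟩ (cs , λ m → trans (p≈q m) (q≈ m))

  ∈⟨⟩-0P : 0P ∈⟨ rs ⟩
  ∈⟨⟩-0P = ∈⟨⟩-by (λ _ → 0P) (λ g → sym (∑-zero (allFin k) (λ _ → refl)))

  ∈⟨⟩-+P : ∀ {p q} → p ∈⟨ rs ⟩ → q ∈⟨ rs ⟩ → p +P q ∈⟨ rs ⟩
  ∈⟨⟩-+P {p} {q} p∈ q∈ with ∈⟨⟩-⟪⟫ p∈ | ∈⟨⟩-⟪⟫ q∈
  ... | cs , ⟪⟫p | ds , ⟪⟫q = ∈⟨⟩-by (λ i → cs i +P ds i) (λ g →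
    trans (⟪⟫-+P g p q) (trans (cong₂ _+_ (⟪⟫p g) (⟪⟫q g)) (trans (sym (∑-+ _ _ (allFin k)))
      (∑-cong (allFin k) (λ i → sym (trans (⟪⟫-resp-≋ g (*P-distribʳ (cs i) (ds i) _)) (⟪⟫-+P g (term cs i) (term ds i))))))))

  ∈⟨⟩-*P : ∀ {p} h → p ∈⟨ rs ⟩ → p *P h ∈⟨ rs ⟩
  ∈⟨⟩-*P {p} h p∈ with ∈⟨⟩-⟪⟫ p∈
  ... | cs , ⟪⟫p = ∈⟨⟩-by (λ i → cs i *P h) (λ g →
    trans (⟪⟫-*P g p h) (trans (⟪⟫p _) (∑-cong (allFin k) (λ i →
      trans (sym (⟪⟫-*P g (term cs i) h)) (⟪⟫-resp-≋ g (rearrange (cs i) (List.lookup rs i)))))))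
    where
    rearrange : ∀ c r → (c *P r) *P h ≋ (c *P h) *P r
    rearrange c r = ≋-trans (*P-assoc c r h) (≋-trans (*P-congʳ c (*P-comm r h)) (≋-sym (*P-assoc c h r)))

  ∈⟨⟩-*Pˡ : ∀ {p} h → p ∈⟨ rs ⟩ → h *P p ∈⟨ rs ⟩
  ∈⟨⟩-*Pˡ {p} h p∈ = ∈⟨⟩-resp-≋ (*P-comm h p) (∈⟨⟩-*P h p∈)

  ∈⟨⟩-lookup : ∀ i → List.lookup rs i ∈⟨ rs ⟩
  ∈⟨⟩-lookup i = ∈⟨⟩-by (λ j → if does (i ≟F j) then 1P else 0P) (λ g → sym (trans
    (∑-cong (allFin k) (unit-at g)) (trans (∑-kronecker i (λ j → ⟪ g ⟫ (1P *P List.lookup rs j)))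
      (⟪⟫-resp-≋ g (*P-identityˡ (List.lookup rs i))))))
    where
    unit-at : ∀ g j → ⟪ g ⟫ ((if does (i ≟F j) then 1P else 0P) *P List.lookup rs j)
                    ≡ kronecker i j (⟪ g ⟫ (1P *P List.lookup rs j))
    unit-at g j with does (i ≟F j)
    ... | true  = refl
    ... | false = refl

  ∈⟨⟩-∈ : ∀ {r} → r ∈ rs → r ∈⟨ rs ⟩
  ∈⟨⟩-∈ r∈ = subst (_∈⟨ rs ⟩) (sym (AnyP.lookup-index r∈)) (∈⟨⟩-lookup (Any.index r∈))

  ∈⟨⟩-sumP : ∀ {A : Set} (F : A → Poly n) xs → (∀ x → x ∈ xs → F x ∈⟨ rs ⟩) → sumP (map F xs) ∈⟨ rs ⟩
  ∈⟨⟩-sumP F []       F∈ = ∈⟨⟩-0P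
  ∈⟨⟩-sumP F (x ∷ xs) F∈ = ∈⟨⟩-+P (F∈ x (here refl)) (∈⟨⟩-sumP F xs (λ y y∈ → F∈ y (there y∈)))

module _ {n : ℕ} where

  unitM : Fin n → Mono n
  unitM i = tabulate (λ j → if does (i ≟F j) then 1 else 0)

  coeff-+P : ∀ (p q : Poly n) m → coeff (p +P q) m ≡ coeff p m + coeff q m
  coeff-+P p q m = trans (coeff≡⟪atMono⟫ (p +P q) m)
    (trans (⟪⟫-+P (atMono m) p q) (sym (cong₂ _+_ (coeff≡⟪atMono⟫ p m) (coeff≡⟪atMono⟫ q m))))

  coeff-negP : ∀ (p : Poly n) m → coeff (-P p) m ≡ - coeff p m
  coeff-negP p m = trans (coeff≡⟪atMono⟫ (-P p) m) (trans (⟪⟫-negP (atMono m) p) (sym (cong -_ (coeff≡⟪atMono⟫ p m))))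

  coeff-single : ∀ c (m₀ m : Mono n) → coeff ((c , m₀) ∷ []) m ≢ 0ℤ → m₀ ≡ m
  coeff-single c m₀ m c≢0 with m₀ ≟M m
  ... | yes m₀≡m = m₀≡m
  ... | no  _    = ⊥-elim (c≢0 refl)

  module _ (S : Fin n → Set) where

    InVars-0P : InVars S 0P
    InVars-0P m c≢0 = ⊥-elim (c≢0 refl)

    InVars-+P : ∀ p q → InVars S p → InVars S q → InVars S (p +P q)
    InVars-+P p q p∈ q∈ m c≢0 with coeff p m ℤ.≟ 0ℤ
    ... | no  cp≢0 = p∈ m cp≢0
    ... | yes cp≡0 = q∈ m (λ cq≡0 → c≢0 (trans (coeff-+P p q m) (cong₂ _+_ cp≡0 cq≡0)))

    InVars-negP : ∀ p → InVars S p → InVars S (-P p)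
    InVars-negP p p∈ m c≢0 = p∈ m (λ c≡0 → c≢0 (trans (coeff-negP p m) (cong -_ c≡0)))

    InVars-minusP : ∀ p q → InVars S p → InVars S q → InVars S (p -P q)
    InVars-minusP p q p∈ q∈ = InVars-+P p (-P q) p∈ (InVars-negP q q∈)

    InVars-*P : ∀ p q → InVars S p → InVars S q → InVars S (p *P q)
    InVars-*P p q p∈ q∈ m c≢0 i i∉S with lookup m i ℕ.≟ 0
    ... | yes mᵢ≡0 = mᵢ≡0
    ... | no  mᵢ≢0 = ⊥-elim (c≢0 (trans (coeff≡⟪atMono⟫ (p *P q) m) (trans (⟪⟫-*P (atMono m) p q)
          (⟪⟫-vanish _ p (λ m₁ c₁ → ⟪⟫-vanish _ q (λ m₂ c₂ → not-m m₁ m₂ (p∈ m₁ c₁ i i∉S) (q∈ m₂ c₂ i i∉S)))))))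
      where
      not-m : ∀ m₁ m₂ → lookup m₁ i ≡ 0 → lookup m₂ i ≡ 0 → atMono m (m₁ +M m₂) ≡ 0ℤ
      not-m m₁ m₂ m₁ᵢ≡0 m₂ᵢ≡0 with m₁ +M m₂ ≟M m
      ... | no  _   = refl
      ... | yes m₁₂≡m = ⊥-elim (mᵢ≢0 (trans (sym (cong (λ u → lookup u i) m₁₂≡m))
                          (trans (VP.lookup-zipWith ℕ._+_ i m₁ m₂) (cong₂ ℕ._+_ m₁ᵢ≡0 m₂ᵢ≡0))))

    InVars-constP : ∀ c → InVars S (constP c)
    InVars-constP c m c≢0 i _ =
      trans (cong (λ u → lookup u i) (sym (coeff-single c (Vec.replicate n 0) m c≢0))) (VP.lookup-replicate i 0)

    InVars-var : ∀ e → S e → InVars S (var e)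
    InVars-var e e∈S m c≢0 i i∉S =
      trans (cong (λ u → lookup u i) (sym (coeff-single 1ℤ (unitM e) m c≢0)))
            (trans (VP.lookup∘tabulate _ i) (exponent (e ≟F i)))
      where
      exponent : (d : Dec (e ≡ i)) → (if does d then 1 else 0) ≡ 0
      exponent (yes refl) = ⊥-elim (i∉S e∈S)
      exponent (no  _)    = refl

-- Evaluation in dual numbers

-- ⟪ constTerm ⟫ p and ⟪ linTerm f ⟫ p are the two components of the image of p under
-- the ring map ℤ[x] → ℤ[ε]/(ε²), xₑ ↦ f(e) ε.
constTerm : ∀ {n} → Mono n → ℤ
constTerm []v          = 1ℤ
constTerm (zero  ∷v m) = constTerm m
constTerm (suc _ ∷v m) = 0ℤ

linTerm : ∀ {n} → (Fin n → ℤ) → Mono n → ℤ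
linTerm f []v                 = 0ℤ
linTerm f (zero        ∷v m) = linTerm (f ∘ fsuc) m
linTerm f (suc zero    ∷v m) = f fzero * constTerm m
linTerm f (suc (suc _) ∷v m) = 0ℤ

constTerm-+M : ∀ {n} (a b : Mono n) → constTerm (a +M b) ≡ constTerm a * constTerm b
constTerm-+M []v         []v         = refl
constTerm-+M (zero ∷v a) (zero ∷v b) = constTerm-+M a b
constTerm-+M (zero ∷v a) (suc _ ∷v b) = sym (ℤP.*-zeroʳ (constTerm a))
constTerm-+M (suc _ ∷v a) (_ ∷v b)   = refl

linTerm-+M : ∀ {n} (f : Fin n → ℤ) (a b : Mono n) →
             linTerm f (a +M b) ≡ constTerm a * linTerm f b + linTerm f a * constTerm b
linTerm-+M f []v []v = refl
linTerm-+M f (zero ∷v a) (zero ∷v b) = linTerm-+M (f ∘ fsuc) a b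
linTerm-+M f (zero ∷v a) (suc zero ∷v b) =
  trans (cong (f fzero *_) (constTerm-+M a b)) (ring (f fzero) (constTerm a) (constTerm b) (linTerm (f ∘ fsuc) a))
  where ring : ∀ x y z w → x * (y * z) ≡ y * (x * z) + w * 0ℤ
        ring = solve-∀
linTerm-+M f (zero ∷v a) (suc (suc _) ∷v b) = ring (constTerm a) (linTerm (f ∘ fsuc) a)
  where ring : ∀ x w → 0ℤ ≡ x * 0ℤ + w * 0ℤ
        ring = solve-∀
linTerm-+M f (suc zero ∷v a) (zero ∷v b) =
  trans (cong (f fzero *_) (constTerm-+M a b)) (ring (f fzero) (constTerm a) (constTerm b))
  where ring : ∀ x y z → x * (y * z) ≡ 0ℤ * 0ℤ + x * y * z
        ring = solve-∀
linTerm-+M f (suc zero ∷v a) (suc y ∷v b) = ring (linTerm f (suc y ∷v b)) (f fzero * constTerm a)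
  where ring : ∀ x w → 0ℤ ≡ 0ℤ * x + w * 0ℤ
        ring = solve-∀
linTerm-+M f (suc (suc _) ∷v a) (y ∷v b) = ring (linTerm f (y ∷v b)) (constTerm (y ∷v b))
  where ring : ∀ x w → 0ℤ ≡ 0ℤ * x + 0ℤ * w
        ring = solve-∀

constTerm-replicate-0 : ∀ n → constTerm (Vec.replicate n 0) ≡ 1ℤ
constTerm-replicate-0 zero    = refl
constTerm-replicate-0 (suc n) = constTerm-replicate-0 n

constTerm-tabulate-0 : ∀ n → constTerm (tabulate {n = n} (λ _ → 0)) ≡ 1ℤ
constTerm-tabulate-0 zero    = refl
constTerm-tabulate-0 (suc n) = constTerm-tabulate-0 n

constTerm-unitM : ∀ {n} (i : Fin n) → constTerm (unitM i) ≡ 0ℤ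
constTerm-unitM fzero    = refl
constTerm-unitM (fsuc i) = constTerm-unitM i

linTerm-unitM : ∀ {n} (f : Fin n → ℤ) (i : Fin n) → linTerm f (unitM i) ≡ f i
linTerm-unitM {suc n} f fzero    = trans (cong (f fzero *_) (constTerm-tabulate-0 n)) (ℤP.*-identityʳ (f fzero))
linTerm-unitM         f (fsuc i) = linTerm-unitM (f ∘ fsuc) i

module DualEvaluation {n : ℕ} (f : Fin n → ℤ) where

  ev₀ ev₁ : Poly n → ℤ
  ev₀ = ⟪ constTerm ⟫
  ev₁ = ⟪ linTerm f ⟫

  ev₀-*P : ∀ p q → ev₀ (p *P q) ≡ ev₀ p * ev₀ q
  ev₀-*P p q = trans (⟪⟫-*P constTerm p q)
    (trans (⟪⟫-cong p (λ m₁ → trans (⟪⟫-cong q (constTerm-+M m₁)) (⟪⟫-scaleˡ (constTerm m₁) constTerm q)))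
           (⟪⟫-scaleʳ (ev₀ q) constTerm p))

  ev₁-*P : ∀ p q → ev₁ (p *P q) ≡ ev₀ p * ev₁ q + ev₁ p * ev₀ q
  ev₁-*P p q = trans (⟪⟫-*P (linTerm f) p q) (trans (⟪⟫-cong p (λ m₁ →
      trans (⟪⟫-cong q (linTerm-+M f m₁))
      (trans (⟪⟫-+fn (λ m₂ → constTerm m₁ * linTerm f m₂) (λ m₂ → linTerm f m₁ * constTerm m₂) q)
             (cong₂ _+_ (⟪⟫-scaleˡ (constTerm m₁) (linTerm f) q) (⟪⟫-scaleˡ (linTerm f m₁) constTerm q)))))
    (trans (⟪⟫-+fn (λ m₁ → constTerm m₁ * ev₁ q) (λ m₁ → linTerm f m₁ * ev₀ q) p)
      (cong₂ _+_ (⟪⟫-scaleʳ (ev₁ q) constTerm p) (⟪⟫-scaleʳ (ev₀ q) (linTerm f) p))))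

  ev₀-var : ∀ i → ev₀ (var i) ≡ 0ℤ
  ev₀-var i = trans (ℤP.+-identityʳ _) (trans (ℤP.*-identityˡ _) (constTerm-unitM i))

  ev₁-var : ∀ i → ev₁ (var i) ≡ f i
  ev₁-var i = trans (ℤP.+-identityʳ _) (trans (ℤP.*-identityˡ _) (linTerm-unitM f i))

  ev₀-1P : ev₀ 1P ≡ 1ℤ
  ev₀-1P = trans (ℤP.+-identityʳ _) (trans (ℤP.*-identityˡ _) (constTerm-replicate-0 n))

  ev₀-esym : ∀ l xs → ev₀ (esym (suc l) xs) ≡ 0ℤ
  ev₀-esym l []       = refl
  ev₀-esym l (x ∷ xs) = trans (⟪⟫-+P constTerm (esym (suc l) xs) (var x *P esym l xs))
    (cong₂ _+_ (ev₀-esym l xs)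
      (trans (ev₀-*P (var x) (esym l xs)) (trans (cong (_* ev₀ (esym l xs)) (ev₀-var x)) (ℤP.*-zeroˡ (ev₀ (esym l xs))))))

  ev₁-esym₁ : ∀ xs → ev₁ (esym 1 xs) ≡ ∑ f xs
  ev₁-esym₁ []       = refl
  ev₁-esym₁ (x ∷ xs) = trans (⟪⟫-+P (linTerm f) (esym 1 xs) (var x *P 1P))
    (trans (cong₂ _+_ (ev₁-esym₁ xs) (trans (ev₁-*P (var x) 1P)
      (trans (cong₂ _+_ (trans (cong (_* ev₁ 1P) (ev₀-var x)) (ℤP.*-zeroˡ (ev₁ 1P))) (cong₂ _*_ (ev₁-var x) ev₀-1P))
        (trans (ℤP.+-identityˡ _) (ℤP.*-identityʳ (f x))))))
    (ℤP.+-comm (∑ f xs) (f x)))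

  ev₁-esym₂₊ : ∀ l xs → ev₁ (esym (suc (suc l)) xs) ≡ 0ℤ
  ev₁-esym₂₊ l []       = refl
  ev₁-esym₂₊ l (x ∷ xs) = trans (⟪⟫-+P (linTerm f) (esym (suc (suc l)) xs) (var x *P esym (suc l) xs))
    (cong₂ _+_ (ev₁-esym₂₊ l xs) (trans (ev₁-*P (var x) (esym (suc l) xs))
      (cong₂ _+_ (trans (cong (_* ev₁ (esym (suc l) xs)) (ev₀-var x)) (ℤP.*-zeroˡ (ev₁ (esym (suc l) xs))))
                 (trans (cong (ev₁ (var x) *_) (ev₀-esym l xs)) (ℤP.*-zeroʳ (ev₁ (var x)))))))

  Killed : Poly n → Set
  Killed r = ev₀ r ≡ 0ℤ × ev₁ r ≡ 0ℤ

  killed-*P : ∀ c r → Killed r → Killed (c *P r)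
  killed-*P c r (r₀ , r₁) =
    trans (ev₀-*P c r) (trans (cong (ev₀ c *_) r₀) (ℤP.*-zeroʳ (ev₀ c))) ,
    trans (ev₁-*P c r) (cong₂ _+_ (trans (cong (ev₀ c *_) r₁) (ℤP.*-zeroʳ (ev₀ c)))
                                  (trans (cong (ev₁ c *_) r₀) (ℤP.*-zeroʳ (ev₁ c))))

  killed-∈⟨⟩ : ∀ {rs p} → All Killed rs → p ∈⟨ rs ⟩ → Killed p
  killed-∈⟨⟩ {rs} {p} rs-killed (mk∈⟨⟩ (cs , p≈)) = vanishes constTerm (proj₁ ∘ killed) , vanishes (linTerm f) (proj₂ ∘ killed)
    where
    k = length rs
    term : Fin k → Poly n
    term i = cs i *P List.lookup rs i
    killed : ∀ i → Killed (term i)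
    killed i = killed-*P (cs i) _ (All.lookup rs-killed (MemP.∈-lookup i))
    vanishes : ∀ g → (∀ i → ⟪ g ⟫ (term i) ≡ 0ℤ) → ⟪ g ⟫ p ≡ 0ℤ
    vanishes g terms≡0 = trans (⟪⟫-resp-≈P g {p} {koszulD1 rs cs} p≈)
      (trans (⟪⟫-sumP g (map term (allFin k))) (trans (∑-map ⟪ g ⟫ term (allFin k)) (∑-zero (allFin k) terms≡0)))

module _ {n : ℕ} where

  linForm : (Fin n → ℤ) → Poly n
  linForm b = sumP (map (λ e → constP (b e) *P var e) (allFin n))

  ⟪⟫-linForm : ∀ (g : Mono n → ℤ) b → ⟪ g ⟫ (linForm b) ≡ ∑ (λ e → b e * ⟪ g ⟫ (var e)) (allFin n)
  ⟪⟫-linForm g b = trans (⟪⟫-sumP g (map (λ e → constP (b e) *P var e) (allFin n)))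
    (trans (∑-map ⟪ g ⟫ (λ e → constP (b e) *P var e) (allFin n)) (∑-cong (allFin n) (λ e → ⟪⟫-constP* g (b e) (var e))))

  ⟪⟫-esym₁ : ∀ (g : Mono n → ℤ) xs → ⟪ g ⟫ (esym 1 xs) ≡ ∑ (⟪ g ⟫ ∘ var) xs
  ⟪⟫-esym₁ g []       = refl
  ⟪⟫-esym₁ g (x ∷ xs) = trans (⟪⟫-+P g (esym 1 xs) (var x *P 1P))
    (trans (cong₂ _+_ (⟪⟫-esym₁ g xs) (⟪⟫-resp-≋ g (*P-identityʳ (var x)))) (ℤP.+-comm _ (⟪ g ⟫ (var x))))

var-reduction : ∀ {n} (e : Fin n) s (c : Fin n → ℤ) →
                var e -P linForm (λ e′ → kronecker e e′ 1ℤ - s * c e′) ≋ constP s *P linForm c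
var-reduction {n} e s c = ≋-ext (λ g → let a = λ e′ → ⟪ g ⟫ (var e′) in begin
  ⟪ g ⟫ (var e -P linForm (λ e′ → kronecker e e′ 1ℤ - s * c e′))
    ≡⟨ trans (⟪⟫-minusP g (var e) (linForm κ)) (cong (λ x → a e - x) (⟪⟫-linForm g κ)) ⟩
  a e - ∑ (λ e′ → (kronecker e e′ 1ℤ - s * c e′) * a e′) Es
    ≡⟨ cong (λ x → a e - x) (trans (∑-cong Es (λ e′ → trans (*-distribʳ-minus (kronecker e e′ 1ℤ) (s * c e′) (a e′))
         (cong₂ _-_ (kronecker-1-* e e′ (a e′)) (ℤP.*-assoc s (c e′) (a e′)))))
         (∑-minus (λ e′ → kronecker e e′ (a e′)) (λ e′ → s * (c e′ * a e′)) Es)) ⟩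
  a e - (∑ (λ e′ → kronecker e e′ (a e′)) Es - ∑ (λ e′ → s * (c e′ * a e′)) Es)
    ≡⟨ cong₂ (λ x y → a e - (x - y)) (∑-kronecker e a) (∑-*ˡ s (λ e′ → c e′ * a e′) Es) ⟩
  a e - (a e - s * ∑ (λ e′ → c e′ * a e′) Es)
    ≡⟨ cancel (a e) (s * ∑ (λ e′ → c e′ * a e′) Es) ⟩
  s * ∑ (λ e′ → c e′ * a e′) Es
    ≡⟨ cong (s *_) (sym (⟪⟫-linForm g c)) ⟩
  s * ⟪ g ⟫ (linForm c)
    ≡⟨ sym (⟪⟫-constP* g s (linForm c)) ⟩
  ⟪ g ⟫ (constP s *P linForm c) ∎)
  where
  open ≡-Reasoning
  Es = allFin n
  κ : Fin n → ℤ
  κ e′ = kronecker e e′ 1ℤ - s * c e′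
  cancel : ∀ x y → x - (x - y) ≡ y
  cancel = solve-∀

-- Circulations and cuts

χ : ∀ {A : Set} → Dec A → ℤ
χ d = if does d then 1ℤ else 0ℤ

χ-yes : ∀ {P : Set} (d : Dec P) → P → χ d ≡ 1ℤ
χ-yes d p = cong (λ b → if b then 1ℤ else 0ℤ) (dec-true d p)

χ-no : ∀ {P : Set} (d : Dec P) → ¬ P → χ d ≡ 0ℤ
χ-no d ¬p = cong (λ b → if b then 1ℤ else 0ℤ) (dec-false d ¬p)

module _ (G : Digraph) where

  private
    V = Fin (nV G)
    E = Fin (nE G)

  Circulation : (E → ℤ) → Set
  Circulation f = ∀ w → ∑ f (outE G w) ≡ ∑ f (inE G w)

  module _ {f : E → ℤ} (circ : Circulation f) where
    open DualEvaluation f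

    circulation-kills-Δ : All Killed (ΔG G)
    circulation-kills-Δ = AllP.concat⁺ (AllP.map⁺ (AllP.tabulate⁺ (λ w → AllP.map⁺ (AllP.applyUpTo⁺₂ (λ l → l) (kw G w) (δ-killed w)))))
      where
      δ-killed : ∀ w l → Killed (δ G w (suc l))
      δ-killed w l = trans (⟪⟫-minusP constTerm (esym (suc l) (outE G w)) (esym (suc l) (inE G w)))
                           (cong₂ _-_ (ev₀-esym l (outE G w)) (ev₀-esym l (inE G w))) ,
                     trans (⟪⟫-minusP (linTerm f) (esym (suc l) (outE G w)) (esym (suc l) (inE G w))) (linear-part l)
        where
        linear-part : ∀ l → ev₁ (esym (suc l) (outE G w)) - ev₁ (esym (suc l) (inE G w)) ≡ 0ℤ
        linear-part zero    = trans (cong₂ _-_ (trans (ev₁-esym₁ (outE G w)) (circ w)) (ev₁-esym₁ (inE G w)))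
                                    (ℤP.+-inverseʳ (∑ f (inE G w)))
        linear-part (suc l) = cong₂ _-_ (ev₁-esym₂₊ l (outE G w)) (ev₁-esym₂₊ l (inE G w))

    circulation-kills-⟨Δ⟩ : ∀ {p} → p ∈⟨ ΔG G ⟩ → Killed p
    circulation-kills-⟨Δ⟩ = killed-∈⟨⟩ circulation-kills-Δ

  δ₁∈⟨Δ⟩ : ∀ w → δ G w 1 ∈⟨ ΔG G ⟩
  δ₁∈⟨Δ⟩ w with kw G w in kw≡
  ... | suc k = ∈⟨⟩-∈ (MemP.∈-concatMap⁺ _ (Any.map (λ { refl → δ₁∈row }) (MemP.∈-allFin w)))
    where δ₁∈row = MemP.∈-map⁺ (λ l → δ G w (suc l)) (MemP.∈-upTo⁺ (subst (0 <_) (sym kw≡) (s≤s z≤n)))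
  ... | zero  = ∈⟨⟩-resp-≋ (≋-ext (λ g → trans (⟪⟫-minusP g (esym 1 (outE G w)) (esym 1 (inE G w)))
                  (cong₂ (λ a b → ⟪ g ⟫ (esym 1 a) - ⟪ g ⟫ (esym 1 b)) (empty (outE G w) (ℕP.m≤m⊔n _ _)) (empty (inE G w) (ℕP.m≤n⊔m _ _))))) ∈⟨⟩-0P
    where
    empty : ∀ (xs : List E) → length xs ≤ kw G w → xs ≡ []
    empty []      _  = refl
    empty (_ ∷ _) le with () ← subst (_ ≤_) kw≡ le

  ⟪⟫-δ₁ : ∀ g w → ⟪ g ⟫ (δ G w 1) ≡
          ∑ (λ e → kronecker (src G e) w (⟪ g ⟫ (var e)) - kronecker (tgt G e) w (⟪ g ⟫ (var e))) (allFin (nE G))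
  ⟪⟫-δ₁ g w = trans (⟪⟫-minusP g (esym 1 (outE G w)) (esym 1 (inE G w)))
    (trans (cong₂ _-_ (trans (⟪⟫-esym₁ g (outE G w)) (∑-filter (λ e → src G e ≟F w) (⟪ g ⟫ ∘ var) (allFin (nE G))))
                      (trans (⟪⟫-esym₁ g (inE G w)) (∑-filter (λ e → tgt G e ≟F w) (⟪ g ⟫ ∘ var) (allFin (nE G)))))
           (sym (∑-minus _ _ (allFin (nE G)))))

  module _ {K : V → Set} (K? : ∀ w → Dec (K w)) where

    crossing : E → ℤ
    crossing e = χ (K? (src G e)) - χ (K? (tgt G e))

    -- ∑_{w ∈ K} δ_{w,1} is the signed sum of the edges crossing the boundary of K.
    cut∈⟨Δ⟩ : linForm crossing ∈⟨ ΔG G ⟩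
    cut∈⟨Δ⟩ = ∈⟨⟩-resp-≋ (≋-ext (λ g → sym (⟪⟫-cut g)))
                (∈⟨⟩-sumP δK (allFin (nV G)) (λ w _ → ∈⟨⟩-*Pˡ (constP (χ (K? w))) (δ₁∈⟨Δ⟩ w)))
      where
      δK : V → Poly (nE G)
      δK w = constP (χ (K? w)) *P δ G w 1

      ⟪⟫-cut : ∀ g → ⟪ g ⟫ (sumP (map δK (allFin (nV G)))) ≡ ⟪ g ⟫ (linForm crossing)
      ⟪⟫-cut g = begin
        ⟪ g ⟫ (sumP (map δK Vs))
          ≡⟨ trans (⟪⟫-sumP g (map δK Vs)) (∑-map ⟪ g ⟫ δK Vs) ⟩
        ∑ (λ w → ⟪ g ⟫ (δK w)) Vs
          ≡⟨ ∑-cong Vs (λ w → trans (⟪⟫-constP* g (χ (K? w)) (δ G w 1)) (trans (cong (χ (K? w) *_) (⟪⟫-δ₁ g w))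
               (trans (sym (∑-*ˡ (χ (K? w)) _ Es)) (∑-cong Es (λ e → scale-δ w e))))) ⟩
        ∑ (λ w → ∑ (λ e → kronecker (src G e) w (χ (K? w) * a e) - kronecker (tgt G e) w (χ (K? w) * a e)) Es) Vs
          ≡⟨ ∑-swap _ Vs Es ⟩
        ∑ (λ e → ∑ (λ w → kronecker (src G e) w (χ (K? w) * a e) - kronecker (tgt G e) w (χ (K? w) * a e)) Vs) Es
          ≡⟨ ∑-cong Es (λ e → trans (∑-minus _ _ Vs) (cong₂ _-_ (∑-kronecker (src G e) _) (∑-kronecker (tgt G e) _))) ⟩
        ∑ (λ e → χ (K? (src G e)) * a e - χ (K? (tgt G e)) * a e) Es
          ≡⟨ ∑-cong Es (λ e → sym (*-distribʳ-minus (χ (K? (src G e))) (χ (K? (tgt G e))) (a e))) ⟩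
        ∑ (λ e → crossing e * a e) Es
          ≡⟨ sym (⟪⟫-linForm g crossing) ⟩
        ⟪ g ⟫ (linForm crossing) ∎
        where
        open ≡-Reasoning
        Vs = allFin (nV G)
        Es = allFin (nE G)
        a : E → ℤ
        a e = ⟪ g ⟫ (var e)
        scale-δ : ∀ w e → χ (K? w) * (kronecker (src G e) w (a e) - kronecker (tgt G e) w (a e))
                        ≡ kronecker (src G e) w (χ (K? w) * a e) - kronecker (tgt G e) w (χ (K? w) * a e)
        scale-δ w e = trans (*-distribˡ-minus (χ (K? w)) (kronecker (src G e) w (a e)) (kronecker (tgt G e) w (a e)))
                            (cong₂ _-_ (kronecker-*ˡ (χ (K? w)) (src G e) w (a e)) (kronecker-*ˡ (χ (K? w)) (tgt G e) w (a e)))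

module Reachability (G : Digraph) (v : Fin (nV G)) {A : Fin (nE G) → Set} (A? : ∀ e → Dec (A e)) where

  private
    V = Fin (nV G)
    E = Fin (nE G)

  Reach : ℕ → V → Set
  Step  : ℕ → E → V → Set
  Reach zero    w = w ≡ v
  Reach (suc t) w = Reach t w ⊎ Σ E (λ e → A e × Step t e w)
  Step t e w = (src G e ≡ w × Reach t (tgt G e)) ⊎ (tgt G e ≡ w × Reach t (src G e))

  reach? : ∀ t w → Dec (Reach t w)
  reach? zero    w = w ≟F v
  reach? (suc t) w = reach? t w ⊎-dec FP.any? (λ e → A? e ×-dec
    (((src G e ≟F w) ×-dec reach? t (tgt G e)) ⊎-dec ((tgt G e ≟F w) ×-dec reach? t (src G e))))

  reach-mono : ∀ {t t′} w → t ≤ t′ → Reach t w → Reach t′ w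
  reach-mono {t} {t′} w t≤t′ r = subst (λ s → Reach s w) (ℕP.m∸n+n≡m t≤t′) (later (t′ ℕ.∸ t) r)
    where later : ∀ d → Reach t w → Reach (d ℕ.+ t) w
          later zero    r = r
          later (suc d) r = inj₁ (later d r)

  step : ∀ {t w x} e → A e → Joins G e w x → Reach t x → Reach (suc t) w
  step e a (inj₁ (s≡w , t≡x)) r = inj₂ (e , a , inj₁ (s≡w , subst (Reach _) (sym t≡x) r))
  step e a (inj₂ (s≡x , t≡w)) r = inj₂ (e , a , inj₂ (t≡w , subst (Reach _) (sym s≡x) r))

  record Path (w : V) : Set where
    field
      k       : ℕ
      ps      : Fin (suc k) → V
      ys      : Fin k → E
      ps-head : ps fzero ≡ w
      ps-last : ps (fromℕ k) ≡ v
      ps-inj  : ∀ i j → ps i ≡ ps j → i ≡ j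
      joins   : ∀ i → Joins G (ys i) (ps (inject₁ i)) (ps (fsuc i))
      allowed : ∀ i → A (ys i)

  walk⇒reach : ∀ k (ps : Fin (suc k) → V) (ys : Fin k → E) → ps (fromℕ k) ≡ v →
               (∀ i → Joins G (ys i) (ps (inject₁ i)) (ps (fsuc i))) → (∀ i → A (ys i)) → Reach k (ps fzero)
  walk⇒reach zero    ps ys last joins allowed = last
  walk⇒reach (suc k) ps ys last joins allowed =
    step (ys fzero) (allowed fzero) (joins fzero) (walk⇒reach k (ps ∘ fsuc) (ys ∘ fsuc) last (joins ∘ fsuc) (allowed ∘ fsuc))

  path⇒reach : ∀ {w} (P : Path w) → Reach (Path.k P) w
  path⇒reach P = subst (Reach k) ps-head (walk⇒reach k ps ys ps-last joins allowed)
    where open Path P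

  private
    -- Prepending a vertex outside Reach t keeps the path simple.
    prepend : ∀ {t x w} (P : Path x) → (∀ i → Reach t (Path.ps P i)) → ¬ Reach t w → Reach (suc t) w →
              ∀ e → A e → Joins G e w x → Σ (Path w) (λ P′ → ∀ i → Reach (suc t) (Path.ps P′ i))
    prepend {t} {x} {w} P inside w∉ w∈ e a J = record
      { k = suc k ; ps = ps′ ; ys = ys′ ; ps-head = refl ; ps-last = ps-last ; ps-inj = inj′
      ; joins = joins′ ; allowed = allowed′ } , inside′
      where
      open Path P
      ps′ : Fin (suc (suc k)) → V
      ps′ fzero    = w
      ps′ (fsuc i) = ps i
      ys′ : Fin (suc k) → E
      ys′ fzero    = e
      ys′ (fsuc i) = ys i
      inj′ : ∀ i j → ps′ i ≡ ps′ j → i ≡ j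
      inj′ fzero    fzero    _  = refl
      inj′ fzero    (fsuc j) eq = ⊥-elim (w∉ (subst (Reach t) (sym eq) (inside j)))
      inj′ (fsuc i) fzero    eq = ⊥-elim (w∉ (subst (Reach t) eq (inside i)))
      inj′ (fsuc i) (fsuc j) eq = cong fsuc (ps-inj i j eq)
      joins′ : ∀ i → Joins G (ys′ i) (ps′ (inject₁ i)) (ps′ (fsuc i))
      joins′ fzero    = subst (Joins G e w) (sym ps-head) J
      joins′ (fsuc i) = joins i
      allowed′ : ∀ i → A (ys′ i)
      allowed′ fzero    = a
      allowed′ (fsuc i) = allowed i
      inside′ : ∀ i → Reach (suc t) (ps′ i)
      inside′ fzero    = w∈
      inside′ (fsuc i) = inj₁ (inside i)

  reach⇒path : ∀ t w → Reach t w → Σ (Path w) (λ P → ∀ i → Reach t (Path.ps P i))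
  reach⇒path zero    w refl = trivial , λ _ → refl
    where trivial = record { k = 0 ; ps = λ _ → v ; ys = λ () ; ps-head = refl ; ps-last = refl
                           ; ps-inj = λ { fzero fzero _ → refl } ; joins = λ () ; allowed = λ () }
  reach⇒path (suc t) w (inj₁ r) = let (P , inside) = reach⇒path t w r in P , inj₁ ∘ inside
  reach⇒path (suc t) w r@(inj₂ (e , a , st)) with reach? t w
  ... | yes r′ = let (P , inside) = reach⇒path t w r′ in P , inj₁ ∘ inside
  ... | no  w∉ with st
  ...   | inj₁ (s≡w , rt) = let (P , inside) = reach⇒path t (tgt G e) rt in prepend P inside w∉ r e a (inj₁ (s≡w , refl))
  ...   | inj₂ (t≡w , rs) = let (P , inside) = reach⇒path t (src G e) rs in prepend P inside w∉ r e a (inj₂ (refl , t≡w))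

  path-bound : ∀ {w} (P : Path w) → Path.k P < nV G
  path-bound P with suc (Path.k P) ℕ.≤? nV G
  ... | yes k<n = k<n
  ... | no  k≮n with FP.pigeonhole (ℕP.≰⇒> k≮n) (Path.ps P)
  ...   | i , j , i<j , eq = ⊥-elim (ℕP.<-irrefl (cong toℕ (Path.ps-inj P i j eq)) i<j)

  -- Simple paths have fewer than nV G edges, so nV G steps reach everything reachable.
  Reachable : V → Set
  Reachable = Reach (nV G)

  reachable? : ∀ w → Dec (Reachable w)
  reachable? = reach? (nV G)

  reachable-v : Reachable v
  reachable-v = reach-mono v z≤n refl

  reachable-step : ∀ {w x} e → A e → Joins G e w x → Reachable x → Reachable w
  reachable-step {w} {x} e a J rx = let (P , _) = reach⇒path (nV G) x rx in
    reach-mono w (path-bound P) (step e a J (path⇒reach P))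

  path-edges-inj : ∀ {w} (P : Path w) i j → Path.ys P i ≡ Path.ys P j → i ≡ j
  path-edges-inj P i j yᵢ≡yⱼ = same-ends (joins i) (subst (λ y → Joins G y (ps (inject₁ j)) (ps (fsuc j))) (sym yᵢ≡yⱼ) (joins j))
    where
    open Path P
    swapped : inject₁ i ≡ fsuc j → fsuc i ≡ inject₁ j → i ≡ j
    swapped e₁ e₂ = ⊥-elim (ℕP.m≢1+m+n (toℕ i) {1} (begin
      toℕ i             ≡⟨ sym (FP.toℕ-inject₁ i) ⟩
      toℕ (inject₁ i)   ≡⟨ cong toℕ e₁ ⟩
      suc (toℕ j)       ≡⟨ cong suc (sym (FP.toℕ-inject₁ j)) ⟩
      suc (toℕ (inject₁ j)) ≡⟨ cong (suc ∘ toℕ) (sym e₂) ⟩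
      suc (suc (toℕ i)) ≡⟨ cong suc (ℕP.+-comm 1 (toℕ i)) ⟩
      suc (toℕ i ℕ.+ 1) ∎))
      where open ≡-Reasoning
    same-ends : Joins G (ys i) (ps (inject₁ i)) (ps (fsuc i)) → Joins G (ys i) (ps (inject₁ j)) (ps (fsuc j)) → i ≡ j
    same-ends (inj₁ (s₁ , t₁)) (inj₁ (s₂ , t₂)) = FP.inject₁-injective (ps-inj _ _ (trans (sym s₁) s₂))
    same-ends (inj₂ (s₁ , t₁)) (inj₂ (s₂ , t₂)) = FP.inject₁-injective (ps-inj _ _ (trans (sym t₁) t₂))
    same-ends (inj₁ (s₁ , t₁)) (inj₂ (s₂ , t₂)) = swapped (ps-inj _ _ (trans (sym s₁) s₂)) (ps-inj _ _ (trans (sym t₁) t₂))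
    same-ends (inj₂ (s₁ , t₁)) (inj₁ (s₂ , t₂)) = swapped (ps-inj _ _ (trans (sym t₁) t₂)) (ps-inj _ _ (trans (sym s₁) s₂))

  module ClosePath {u : V} (P : Path u) (e : E) (J : Joins G e v u) (e∉P : ∀ i → Path.ys P i ≢ e) where
    open Path P

    -- Mirrors the definition of next: the last position carries e.
    xs : Fin (suc k) → E
    xs i with toℕ i ℕ.≟ k
    ... | yes _   = e
    ... | no  i≢k = ys (lower₁ i (i≢k ∘ sym))

    cycle-joins : ∀ i → Joins G (xs i) (ps i) (ps (next G i))
    cycle-joins i with toℕ i ℕ.≟ k
    ... | yes i≡k = subst (λ z → Joins G e z (ps fzero)) (trans (sym ps-last) (cong ps (sym i≡last)))
                      (subst (Joins G e v) (sym ps-head) J)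
      where i≡last = FP.toℕ-injective (trans i≡k (sym (FP.toℕ-fromℕ k)))
    ... | no  i≢k = subst (λ z → Joins G (ys j) z (ps (lower₁ (fsuc i) k≢i+1)))
                      (cong ps (FP.inject₁-lower₁ i (i≢k ∘ sym)))
                      (subst (λ z → Joins G (ys j) (ps (inject₁ j)) (ps z)) j+1≡ (joins j))
      where
      j = lower₁ i (i≢k ∘ sym)
      k≢i+1 = λ eq → i≢k (sym (ℕP.suc-injective eq))
      j+1≡ : fsuc j ≡ lower₁ (fsuc i) k≢i+1
      j+1≡ = FP.toℕ-injective (trans (cong suc (FP.toℕ-lower₁ i (i≢k ∘ sym))) (sym (FP.toℕ-lower₁ (fsuc i) k≢i+1)))

    xs-inj : ∀ i j → xs i ≡ xs j → i ≡ j
    xs-inj i j eq with toℕ i ℕ.≟ k | toℕ j ℕ.≟ k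
    ... | yes i≡k | yes j≡k = FP.toℕ-injective (trans i≡k (sym j≡k))
    ... | yes _   | no  _   = ⊥-elim (e∉P _ (sym eq))
    ... | no  _   | yes _   = ⊥-elim (e∉P _ eq)
    ... | no  i≢k | no  j≢k = FP.toℕ-injective (trans (sym (FP.toℕ-lower₁ i (i≢k ∘ sym)))
                                (trans (cong toℕ (path-edges-inj P _ _ eq)) (FP.toℕ-lower₁ j (j≢k ∘ sym))))

    cycle : Cycle G
    cycle = record { len = k ; vs = ps ; xs = xs ; vs-inj = ps-inj ; xs-inj = xs-inj ; joins = cycle-joins }

    through : Through G v cycle
    through = fromℕ k , ps-last

    uses : ∀ e′ → Uses G cycle e′ → e′ ≡ e ⊎ Σ (Fin k) (λ j → ys j ≡ e′)
    uses e′ (i , eq) with toℕ i ℕ.≟ k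
    ... | yes _ = inj₁ (sym eq)
    ... | no  _ = inj₂ (_ , eq)

module _ (G : Digraph) where

  next-last : ∀ {n} (i : Fin (suc n)) → toℕ i ≡ n → next G i ≡ fzero
  next-last {n} i i≡n with toℕ i ℕ.≟ n
  ... | yes _   = refl
  ... | no  i≢n = ⊥-elim (i≢n i≡n)

  toℕ-next : ∀ {n} (i : Fin (suc n)) → toℕ i ≢ n → toℕ (next G i) ≡ suc (toℕ i)
  toℕ-next {n} i i≢n with toℕ i ℕ.≟ n
  ... | yes i≡n = ⊥-elim (i≢n i≡n)
  ... | no  i≢n′ = FP.toℕ-lower₁ (fsuc i) (λ eq → i≢n′ (sym (ℕP.suc-injective eq)))

  prev : ∀ {n} → Fin (suc n) → Fin (suc n)
  prev {n} fzero    = fromℕ n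
  prev     (fsuc j) = inject₁ j

  prev-next : ∀ {n} (i : Fin (suc n)) → prev (next G i) ≡ i
  prev-next {n} i with toℕ i ℕ.≟ n
  ... | yes i≡n = FP.toℕ-injective (trans (FP.toℕ-fromℕ n) (sym i≡n))
  ... | no  i≢n = FP.toℕ-injective (toℕ-prev (lower₁ (fsuc i) n≢i+1) (FP.toℕ-lower₁ (fsuc i) n≢i+1))
    where n≢i+1 = λ eq → i≢n (sym (ℕP.suc-injective eq))
          toℕ-prev : ∀ x → toℕ x ≡ suc (toℕ i) → toℕ (prev x) ≡ toℕ i
          toℕ-prev (fsuc y) x≡ = trans (FP.toℕ-inject₁ y) (ℕP.suc-injective x≡)

  next-prev : ∀ {n} (j : Fin (suc n)) → next G (prev j) ≡ j
  next-prev {n} fzero    = next-last (fromℕ n) (FP.toℕ-fromℕ n)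
  next-prev {n} (fsuc y) = FP.toℕ-injective (trans (toℕ-next (inject₁ y) y≢n) (cong suc (FP.toℕ-inject₁ y)))
    where y≢n : toℕ (inject₁ y) ≢ n
          y≢n y≡n = ℕP.<-irrefl y≡n (subst (ℕ._< n) (sym (FP.toℕ-inject₁ y)) (FP.toℕ<n y))

  ∑-next : ∀ {n} (h : Fin (suc n) → ℤ) → ∑ (h ∘ next G) (allFin (suc n)) ≡ ∑ h (allFin (suc n))
  ∑-next {n} h = begin
    ∑ (h ∘ next G) is                                                ≡⟨ ∑-cong is (λ i → sym (∑-kronecker (next G i) h)) ⟩
    ∑ (λ i → ∑ (λ j → kronecker (next G i) j (h j)) is) is           ≡⟨ ∑-swap (λ i j → kronecker (next G i) j (h j)) is is ⟩
    ∑ (λ j → ∑ (λ i → kronecker (next G i) j (h j)) is) is           ≡⟨ ∑-cong is (λ j → ∑-cong is (λ i → flip i j)) ⟩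
    ∑ (λ j → ∑ (λ i → kronecker (prev j) i (h j)) is) is             ≡⟨ ∑-cong is (λ j → ∑-kronecker (prev j) (λ _ → h j)) ⟩
    ∑ h is                                                           ∎
    where
    open ≡-Reasoning
    is = allFin (suc n)
    flip : ∀ i j → kronecker (next G i) j (h j) ≡ kronecker (prev j) i (h j)
    flip i j = cong (λ b → if b then h j else 0ℤ) (does-⇔ (next G i ≟F j) (prev j ≟F i)
                 (λ i′≡j → trans (cong prev (sym i′≡j)) (prev-next i)) (λ j′≡i → trans (cong (next G) (sym j′≡i)) (next-prev j)))

module CycleCirculation (G : Digraph) (C : Cycle G) where
  open Cycle C

  private
    is = allFin (suc len)

  orient : Fin (suc len) → ℤ
  orient i = if does (src G (xs i) ≟F vs i) then 1ℤ else - 1ℤ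

  flow : Fin (nE G) → ℤ
  flow e = ∑ (λ i → kronecker (xs i) e (orient i)) is

  private
    at : (Fin (nE G) → Fin (nV G)) → Fin (nV G) → Fin (suc len) → ℤ
    at end w i = if does (end (xs i) ≟F w) then orient i else 0ℤ

    ∑-flow-filter : ∀ (end : Fin (nE G) → Fin (nV G)) w →
                    ∑ flow (filter (λ e → end e ≟F w) (allFin (nE G))) ≡ ∑ (at end w) is
    ∑-flow-filter end w = trans (∑-filter (λ e → end e ≟F w) flow (allFin (nE G)))
      (trans (∑-cong (allFin (nE G)) (λ e → guard-∑ e (does (end e ≟F w))))
      (trans (∑-swap (λ e i → if does (end e ≟F w) then kronecker (xs i) e (orient i) else 0ℤ) (allFin (nE G)) is)
      (∑-cong is (λ i → trans (∑-cong (allFin (nE G)) (guard-kronecker i)) (∑-kronecker (xs i) (λ e → if does (end e ≟F w) then orient i else 0ℤ))))))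
      where
      guard-∑ : ∀ e b → (if b then flow e else 0ℤ) ≡ ∑ (λ i → if b then kronecker (xs i) e (orient i) else 0ℤ) is
      guard-∑ e true  = refl
      guard-∑ e false = sym (∑-zero is (λ _ → refl))
      guard-kronecker : ∀ i e → (if does (end e ≟F w) then kronecker (xs i) e (orient i) else 0ℤ)
                              ≡ kronecker (xs i) e (if does (end e ≟F w) then orient i else 0ℤ)
      guard-kronecker i e with does (end e ≟F w) | does (xs i ≟F e)
      ... | true  | _     = refl
      ... | false | true  = refl
      ... | false | false = refl

    visits : Fin (nV G) → Fin (suc len) → ℤ
    visits w i = if does (vs i ≟F w) then 1ℤ else 0ℤ

    -- Each edge of the cycle leaves one of its two consecutive vertices and enters the other.
    telescope : ∀ w i → at (src G) w i - at (tgt G) w i ≡ visits w i - visits w (next G i)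
    telescope w i with joins i
    ... | inj₁ (s , t) rewrite s | t with vs i ≟F vs i
    ...   | yes _  = refl
    ...   | no  ≢ = ⊥-elim (≢ refl)
    telescope w i | inj₂ (s , t) rewrite s | t with vs (next G i) ≟F vs i
    ...   | yes loop rewrite loop = trans (ℤP.+-inverseʳ (visits w i)) (sym (ℤP.+-inverseʳ (visits w i)))
    ...   | no  _ with does (vs (next G i) ≟F w) | does (vs i ≟F w)
    ...     | true  | true  = refl
    ...     | true  | false = refl
    ...     | false | true  = refl
    ...     | false | false = refl

  flow-circulation : Circulation G flow
  flow-circulation w = begin
    ∑ flow (outE G w)                   ≡⟨ ∑-flow-filter (src G) w ⟩
    ∑ (at (src G) w) is                 ≡⟨ ℤP.i-j≡0⇒i≡j _ _ balance ⟩
    ∑ (at (tgt G) w) is                 ≡⟨ sym (∑-flow-filter (tgt G) w) ⟩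
    ∑ flow (inE G w)                    ∎
    where
    open ≡-Reasoning
    balance : ∑ (at (src G) w) is - ∑ (at (tgt G) w) is ≡ 0ℤ
    balance = begin
      ∑ (at (src G) w) is - ∑ (at (tgt G) w) is               ≡⟨ sym (∑-minus (at (src G) w) (at (tgt G) w) is) ⟩
      ∑ (λ i → at (src G) w i - at (tgt G) w i) is            ≡⟨ ∑-cong is (telescope w) ⟩
      ∑ (λ i → visits w i - visits w (next G i)) is           ≡⟨ ∑-minus (visits w) (visits w ∘ next G) is ⟩
      ∑ (visits w) is - ∑ (visits w ∘ next G) is              ≡⟨ cong (λ x → ∑ (visits w) is - x) (∑-next G (visits w)) ⟩
      ∑ (visits w) is - ∑ (visits w) is                       ≡⟨ ℤP.+-inverseʳ (∑ (visits w) is) ⟩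
      0ℤ                                                      ∎

  flow-on-cycle : ∀ j → flow (xs j) ≡ orient j
  flow-on-cycle j = trans (∑-cong is (λ i → cong (λ b → if b then orient i else 0ℤ)
      (does-⇔ (xs i ≟F xs j) (j ≟F i) (λ eq → sym (xs-inj i j eq)) (λ eq → cong xs (sym eq)))))
    (∑-kronecker j orient)

  flow-off-cycle : ∀ e → (∀ i → xs i ≢ e) → flow e ≡ 0ℤ
  flow-off-cycle e e∉C = ∑-zero is off
    where off : ∀ i → kronecker (xs i) e (orient i) ≡ 0ℤ
          off i with xs i ≟F e
          ... | yes xᵢ≡e = ⊥-elim (e∉C i xᵢ≡e)
          ... | no  _    = refl

  orient≢0 : ∀ j → orient j ≢ 0ℤ
  orient≢0 j with does (src G (xs j) ≟F vs j)
  ... | true  = λ ()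
  ... | false = λ ()

constTerm≡atMono-0 : ∀ {n} (m : Mono n) → constTerm m ≡ atMono (Vec.replicate n 0) m
constTerm≡atMono-0 []v          = refl
constTerm≡atMono-0 (zero  ∷v m) = constTerm≡atMono-0 m
constTerm≡atMono-0 (suc _ ∷v m) = refl

coeff-0≡ev₀ : ∀ {n} (p : Poly n) → coeff p (Vec.replicate n 0) ≡ ⟪ constTerm ⟫ p
coeff-0≡ev₀ p = trans (coeff≡⟪atMono⟫ p _) (sym (⟪⟫-cong p constTerm≡atMono-0))

degM-unitM : ∀ {n} (e : Fin n) → degM (unitM e) ≡ 1
degM-unitM {suc n} fzero    = cong suc (zero-tail n)
  where zero-tail : ∀ n → degM (tabulate {n = n} (λ _ → 0)) ≡ 0
        zero-tail zero    = refl
        zero-tail (suc n) = zero-tail n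
degM-unitM         (fsuc e) = degM-unitM e

degM≢1-zeros : ∀ {n} → degM (Vec.replicate n 0) ≢ 1
degM≢1-zeros {zero}  ()
degM≢1-zeros {suc n} = degM≢1-zeros {n}

degM≡1⇒unitM : ∀ {n} (m : Mono n) → degM m ≡ 1 → Σ (Fin n) (λ e → m ≡ unitM e)
degM≡1⇒unitM []v                ()
degM≡1⇒unitM (zero ∷v m)        h = let (e , m≡) = degM≡1⇒unitM m h in fsuc e , cong (0 ∷v_) m≡
degM≡1⇒unitM (suc zero ∷v m)    h = fzero , cong (1 ∷v_) (zeros-tab m (ℕP.suc-injective h))
  where zeros-tab : ∀ {n} (m : Mono n) → degM m ≡ 0 → m ≡ tabulate (λ _ → 0)
        zeros-tab []v          _ = refl
        zeros-tab (zero ∷v m) h = cong (0 ∷v_) (zeros-tab m h)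
degM≡1⇒unitM (suc (suc _) ∷v m) ()

module _ {n : ℕ} where

  lookup-unitM : (e j : Fin n) → lookup (unitM e) j ≡ (if does (e ≟F j) then 1 else 0)
  lookup-unitM e j = VP.lookup∘tabulate _ j

  unitM-injective : (e e′ : Fin n) → unitM e ≡ unitM e′ → e ≡ e′
  unitM-injective e e′ eq with e ≟F e′ | trans (sym (lookup-unitM e e)) (trans (cong (λ u → lookup u e) eq) (lookup-unitM e′ e))
  ... | yes e≡e′ | _ = e≡e′
  ... | no  _    | h with e ≟F e | e′ ≟F e
  ...   | yes _ | yes e′≡e = sym e′≡e
  ...   | yes _ | no  _    = ⊥-elim (ℕP.1+n≢0 h)
  ...   | no  ≢ | _        = ⊥-elim (≢ refl)

  ⟪⟫-agree : ∀ (g h : Mono n → ℤ) p → (∀ m → coeff p m ≢ 0ℤ → g m ≡ h m) → ⟪ g ⟫ p ≡ ⟪ h ⟫ p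
  ⟪⟫-agree g h p agree = ℤP.i-j≡0⇒i≡j _ _ (begin
    ⟪ g ⟫ p - ⟪ h ⟫ p               ≡⟨ cong (⟪ g ⟫ p +_) (sym ⟪⟫-neg-h) ⟩
    ⟪ g ⟫ p + ⟪ (λ m → - h m) ⟫ p   ≡⟨ sym (⟪⟫-+fn g (λ m → - h m) p) ⟩
    ⟪ (λ m → g m - h m) ⟫ p         ≡⟨ ⟪⟫-vanish _ p (λ m c≢0 → trans (cong (_- h m) (agree m c≢0)) (ℤP.+-inverseʳ (h m))) ⟩
    0ℤ                              ∎)
    where open ≡-Reasoning
          ⟪⟫-neg-h : ⟪ (λ m → - h m) ⟫ p ≡ - ⟪ h ⟫ p
          ⟪⟫-neg-h = trans (∑-cong p (λ t → sym (ℤP.neg-distribʳ-* (proj₁ t) (h (proj₂ t))))) (∑-neg _ p)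

  homog₁≋linForm : ∀ p → Homog 1 p → p ≋ linForm (λ e → coeff p (unitM e))
  homog₁≋linForm p hom = ≋-ext same
    where
    same : ∀ g → ⟪ g ⟫ p ≡ ⟪ g ⟫ (linForm (λ e → coeff p (unitM e)))
    same g = begin
      ⟪ g ⟫ p
        ≡⟨ ⟪⟫-agree g ĝ p on-support ⟩
      ⟪ ĝ ⟫ p
        ≡⟨ ⟪⟫-∑fn (λ e m → atMono (unitM e) m * g (unitM e)) Es p ⟩
      ∑ (λ e → ⟪ (λ m → atMono (unitM e) m * g (unitM e)) ⟫ p) Es
        ≡⟨ ∑-cong Es (λ e → trans (⟪⟫-scaleʳ (g (unitM e)) (atMono (unitM e)) p)
                                  (cong (_* g (unitM e)) (sym (coeff≡⟪atMono⟫ p (unitM e))))) ⟩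
      ∑ (λ e → coeff p (unitM e) * g (unitM e)) Es
        ≡⟨ ∑-cong Es (λ e → cong (coeff p (unitM e) *_) (sym (trans (ℤP.+-identityʳ _) (ℤP.*-identityˡ _)))) ⟩
      ∑ (λ e → coeff p (unitM e) * ⟪ g ⟫ (var e)) Es
        ≡⟨ sym (⟪⟫-linForm g (λ e → coeff p (unitM e))) ⟩
      ⟪ g ⟫ (linForm (λ e → coeff p (unitM e))) ∎
      where
      open ≡-Reasoning
      Es = allFin n
      ĝ : Mono n → ℤ
      ĝ m = ∑ (λ e → atMono (unitM e) m * g (unitM e)) Es
      on-support : ∀ m → coeff p m ≢ 0ℤ → g m ≡ ĝ m
      on-support m c≢0 with degM≡1⇒unitM m (hom m c≢0)
      ... | e₀ , refl = sym (trans (∑-cong Es pick) (∑-kronecker e₀ (λ e → g (unitM e))))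
        where pick : ∀ e → atMono (unitM e) (unitM e₀) * g (unitM e) ≡ kronecker e₀ e (g (unitM e))
              pick e with unitM e₀ ≟M unitM e | e₀ ≟F e
              ... | yes _  | yes _    = ℤP.*-identityˡ (g (unitM e))
              ... | no  _  | no  _    = ℤP.*-zeroˡ (g (unitM e))
              ... | yes eq | no  ≢    = ⊥-elim (≢ (unitM-injective e₀ e eq))
              ... | no  ≢  | yes refl = ⊥-elim (≢ refl)

decrementAt : ∀ {n} → Fin n → Mono n → Mono n
decrementAt fzero    (x ∷v m) = ℕ.pred x ∷v m
decrementAt (fsuc i) (x ∷v m) = x ∷v decrementAt i m

decrementAt-+M-unitM : ∀ {n} (i : Fin n) (m : Mono n) → lookup m i ≢ 0 → decrementAt i m +M unitM i ≡ m
decrementAt-+M-unitM fzero    (zero  ∷v m) mᵢ≢0 = ⊥-elim (mᵢ≢0 refl)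
decrementAt-+M-unitM fzero    (suc x ∷v m) _    = cong₂ _∷v_ (ℕP.+-comm x 1) (+M-zeros m)
  where +M-zeros : ∀ {n} (m : Mono n) → m +M tabulate (λ _ → 0) ≡ m
        +M-zeros []v      = refl
        +M-zeros (x ∷v m) = cong₂ _∷v_ (ℕP.+-identityʳ x) (+M-zeros m)
decrementAt-+M-unitM (fsuc i) (x ∷v m) mᵢ≢0 = cong₂ _∷v_ (ℕP.+-identityʳ x) (decrementAt-+M-unitM i m mᵢ≢0)

lookup-decrementAt : ∀ {n} (i j : Fin n) (m : Mono n) → i ≢ j → lookup (decrementAt i m) j ≡ lookup m j
lookup-decrementAt fzero    fzero    m        i≢j = ⊥-elim (i≢j refl)
lookup-decrementAt fzero    (fsuc j) (x ∷v m) _   = refl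
lookup-decrementAt (fsuc i) fzero    (x ∷v m) _   = refl
lookup-decrementAt (fsuc i) (fsuc j) (x ∷v m) i≢j = lookup-decrementAt i j m (i≢j ∘ cong fsuc)

lookup-0⇒zeros : ∀ {n} (m : Mono n) → (∀ i → lookup m i ≡ 0) → m ≡ Vec.replicate n 0
lookup-0⇒zeros []v      _   = refl
lookup-0⇒zeros (x ∷v m) m≡0 = cong₂ _∷v_ (m≡0 fzero) (lookup-0⇒zeros m (m≡0 ∘ fsuc))

module AtVertex (G : Digraph) (v : Fin (nV G)) where

  private
    E = Fin (nE G)
    zeros = Vec.replicate (nE G) 0

  Inc? : ∀ e → Dec (Inc G v e)
  Inc? e = (src G e ≟F v) ⊎-dec (tgt G e ≟F v)

  InR-var : ∀ e → Inc G v e → InR G v (var e)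
  InR-var = InVars-var (Inc G v)

  InR-homog₁-coeff : ∀ p → InR G v p → ∀ e → ¬ Inc G v e → coeff p (unitM e) ≡ 0ℤ
  InR-homog₁-coeff p p∈R e e∉ with coeff p (unitM e) ℤ.≟ 0ℤ
  ... | yes c≡0 = c≡0
  ... | no  c≢0 = ⊥-elim (ℕP.1+n≢0 (trans (sym (exponent (e ≟F e))) (trans (sym (lookup-unitM e e)) (p∈R (unitM e) c≢0 e e∉))))
    where exponent : (d : Dec (e ≡ e)) → (if does d then 1 else 0) ≡ 1
          exponent (yes _) = refl
          exponent (no ≢)  = ⊥-elim (≢ refl)

  private
    incSum : (E → EdgePoly G) → EdgePoly G
    incSum c = sumP (map (λ e → c e *P var e) (incE G v))

    ⟪⟫-incSum : ∀ g c → ⟪ g ⟫ (incSum c) ≡ ∑ (λ e → ⟪ g ⟫ (c e *P var e)) (incE G v)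
    ⟪⟫-incSum g c = trans (⟪⟫-sumP g (map (λ e → c e *P var e) (incE G v))) (∑-map ⟪ g ⟫ (λ e → c e *P var e) (incE G v))

    IdealEv-by : ∀ p c → (∀ e → InR G v (c e)) → (∀ g → ⟪ g ⟫ p ≡ ⟪ g ⟫ (incSum c)) → IdealEv G v p
    IdealEv-by p c c∈R ⟪⟫p = c , c∈R , coeff-≡ (≋-ext {p = p} {q = incSum c} ⟪⟫p)

  IdealEv-≋ : ∀ {p q} → p ≋ q → IdealEv G v q → IdealEv G v p
  IdealEv-≋ (mk≋ p≈q) (c , c∈R , q≈) = c , c∈R , λ m → trans (p≈q m) (q≈ m)

  IdealEv-0P : IdealEv G v 0P
  IdealEv-0P = IdealEv-by 0P (λ _ → 0P) (λ _ → InVars-0P (Inc G v)) (λ g → sym (trans (⟪⟫-incSum g (λ _ → 0P)) (∑-zero (incE G v) (λ _ → refl))))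

  IdealEv-+P : ∀ {p q} → IdealEv G v p → IdealEv G v q → IdealEv G v (p +P q)
  IdealEv-+P {p} {q} (c , c∈R , p≈) (d , d∈R , q≈) =
    IdealEv-by (p +P q) (λ e → c e +P d e) (λ e → InVars-+P (Inc G v) (c e) (d e) (c∈R e) (d∈R e)) (λ g →
      trans (⟪⟫-+P g p q) (trans (cong₂ _+_ (⟪⟫-resp-≈P g {p} {incSum c} p≈) (⟪⟫-resp-≈P g {q} {incSum d} q≈))
      (trans (cong₂ _+_ (⟪⟫-incSum g c) (⟪⟫-incSum g d)) (trans (sym (∑-+ _ _ (incE G v)))
      (trans (∑-cong (incE G v) (λ e → sym (trans (⟪⟫-resp-≋ g (*P-distribʳ (c e) (d e) (var e))) (⟪⟫-+P g (c e *P var e) (d e *P var e)))))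
        (sym (⟪⟫-incSum g (λ e → c e +P d e))))))))

  IdealEv-negP : ∀ {p} → IdealEv G v p → IdealEv G v (-P p)
  IdealEv-negP {p} (c , c∈R , p≈) =
    IdealEv-by (-P p) (λ e → -P c e) (λ e → InVars-negP (Inc G v) (c e) (c∈R e)) (λ g →
      trans (⟪⟫-negP g p) (trans (cong -_ (trans (⟪⟫-resp-≈P g {p} {incSum c} p≈) (⟪⟫-incSum g c)))
      (trans (sym (∑-neg _ (incE G v)))
      (trans (∑-cong (incE G v) (λ e → sym (trans (⟪⟫-resp-≋ g (-P-*P (c e) (var e))) (⟪⟫-negP g (c e *P var e)))))
        (sym (⟪⟫-incSum g (λ e → -P c e)))))))

  IdealEv⇒∈⟨Δ⟩ : ∀ {p} → IdealEv G v p → (∀ e → Inc G v e → var e ∈⟨ ΔG G ⟩) → p ∈⟨ ΔG G ⟩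
  IdealEv⇒∈⟨Δ⟩ {p} (c , _ , p≈) vars∈ = ∈⟨⟩-resp-≋ (mk≋ {p = p} {q = incSum c} p≈)
    (∈⟨⟩-sumP (λ e → c e *P var e) (incE G v) (λ e e∈ → ∈⟨⟩-*Pˡ (c e) (vars∈ e (proj₂ (MemP.∈-filter⁻ Inc? {xs = allFin (nE G)} e∈)))))

  private
    -- Monomials of ℤ[E(v)] other than 1: exactly those lying in (E(v)).
    Good : Mono (nE G) → Set
    Good m = (m ≢ zeros) × (∀ i → Inc G v i ⊎ lookup m i ≡ 0)

    good? : ∀ m → Dec (Good m)
    good? m = ¬? (m ≟M zeros) ×-dec FP.all? (λ i → Inc? i ⊎-dec (lookup m i ℕ.≟ 0))

    goodTerm? : ∀ (t : ℤ × Mono (nE G)) → Dec (Good (proj₂ t))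
    goodTerm? = good? ∘ proj₂

    IdealEv-*P-var : ∀ q i → InR G v q → Inc G v i → IdealEv G v (q *P var i)
    IdealEv-*P-var q i q∈R i-at-v = IdealEv-by (q *P var i) cofactor cofactor∈R (λ g → sym (begin
      ⟪ g ⟫ (incSum cofactor)
        ≡⟨ trans (⟪⟫-incSum g cofactor) (∑-filter Inc? _ (allFin (nE G))) ⟩
      ∑ (λ e → if does (Inc? e) then ⟪ g ⟫ (cofactor e *P var e) else 0ℤ) (allFin (nE G))
        ≡⟨ ∑-cong (allFin (nE G)) (only-i g) ⟩
      ∑ (λ e → kronecker i e (⟪ g ⟫ (q *P var i))) (allFin (nE G))
        ≡⟨ ∑-kronecker i _ ⟩
      ⟪ g ⟫ (q *P var i) ∎))
      where
      open ≡-Reasoning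
      cofactor : E → EdgePoly G
      cofactor e = if does (i ≟F e) then q else 0P
      cofactor∈R : ∀ e → InR G v (cofactor e)
      cofactor∈R e with does (i ≟F e)
      ... | true  = q∈R
      ... | false = InVars-0P (Inc G v)
      only-i : ∀ g e → (if does (Inc? e) then ⟪ g ⟫ (cofactor e *P var e) else 0ℤ) ≡ kronecker i e (⟪ g ⟫ (q *P var i))
      only-i g e with i ≟F e
      only-i g e | yes refl with src G i ≟F v | tgt G i ≟F v
      ... | yes _ | _     = refl
      ... | no  _ | yes _ = refl
      ... | no  s | no  t = ⊥-elim ([ s , t ]′ i-at-v)
      only-i g e | no _ with does (Inc? e)
      ... | true  = refl
      ... | false = refl

    -- A good monomial has a positive exponent at some i ∈ E(v); factor out xᵢ.
    IdealEv-good : ∀ c m → Good m → IdealEv G v ((c , m) ∷ [])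
    IdealEv-good c m (m≢0 , m∈R) with FP.any? (λ i → ¬? (lookup m i ℕ.≟ 0))
    ... | no  all0 = ⊥-elim (m≢0 (lookup-0⇒zeros m (λ i → decidable-stable (lookup m i ℕ.≟ 0) (λ mᵢ≢0 → all0 (i , mᵢ≢0)))))
    ... | yes (i , mᵢ≢0) = IdealEv-≋ factor (IdealEv-*P-var lowered i lowered∈R i-at-v)
      where
      i-at-v : Inc G v i
      i-at-v = [ (λ i∈ → i∈) , (λ mᵢ≡0 → ⊥-elim (mᵢ≢0 mᵢ≡0)) ]′ (m∈R i)
      lowered : EdgePoly G
      lowered = (c , decrementAt i m) ∷ []
      lowered∈R : InR G v lowered
      lowered∈R m′ c≢0 j j-off = trans (cong (λ u → lookup u j) (sym (coeff-single c (decrementAt i m) m′ c≢0)))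
        (trans (lookup-decrementAt i j m (λ i≡j → j-off (subst (Inc G v) i≡j i-at-v)))
               ([ (λ j-at-v → ⊥-elim (j-off j-at-v)) , (λ mⱼ≡0 → mⱼ≡0) ]′ (m∈R j)))
      factor : (c , m) ∷ [] ≋ lowered *P var i
      factor = ≋-ext (λ g → sym (trans (⟪⟫-*P g lowered (var i)) (trans
        (cong (λ u → c * (1ℤ * g u + 0ℤ) + 0ℤ) (decrementAt-+M-unitM i m mᵢ≢0))
        (cong (λ x → c * x + 0ℤ) (trans (ℤP.+-identityʳ _) (ℤP.*-identityˡ _))))))

    IdealEv-filter-good : ∀ p → IdealEv G v (filter goodTerm? p)
    IdealEv-filter-good []            = IdealEv-0P
    IdealEv-filter-good ((c , m) ∷ p) with good? m
    ... | yes good = subst (IdealEv G v) (sym (LP.filter-accept goodTerm? good))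
                       (IdealEv-+P {(c , m) ∷ []} (IdealEv-good c m good) (IdealEv-filter-good p))
    ... | no  bad  = subst (IdealEv G v) (sym (LP.filter-reject goodTerm? bad)) (IdealEv-filter-good p)

    coeff-filter-good : ∀ p m → coeff (filter goodTerm? p) m ≡ (if does (good? m) then coeff p m else 0ℤ)
    coeff-filter-good p m = begin
      coeff (filter goodTerm? p) m
        ≡⟨ trans (coeff≡⟪atMono⟫ (filter goodTerm? p) m) (∑-filter goodTerm? _ p) ⟩
      ∑ (λ t → if does (good? (proj₂ t)) then proj₁ t * atMono m (proj₂ t) else 0ℤ) p
        ≡⟨ ∑-cong p guard-inside ⟩
      ⟪ (λ m′ → if does (good? m) then atMono m m′ else 0ℤ) ⟫ p
        ≡⟨ guard-outside (good? m) ⟩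
      (if does (good? m) then coeff p m else 0ℤ) ∎
      where
      open ≡-Reasoning
      guard-inside : ∀ (t : ℤ × Mono (nE G)) → (if does (good? (proj₂ t)) then proj₁ t * atMono m (proj₂ t) else 0ℤ)
                                            ≡ proj₁ t * (if does (good? m) then atMono m (proj₂ t) else 0ℤ)
      guard-inside (c , m′) with m′ ≟M m
      ... | yes refl with does (good? m′)
      ...   | true  = refl
      ...   | false = sym (ℤP.*-zeroʳ c)
      guard-inside (c , m′) | no _ with does (good? m′) | does (good? m)
      ...   | true  | true  = refl
      ...   | true  | false = refl
      ...   | false | true  = sym (ℤP.*-zeroʳ c)
      ...   | false | false = sym (ℤP.*-zeroʳ c)
      guard-outside : (d : Dec (Good m)) → ⟪ (λ m′ → if does d then atMono m m′ else 0ℤ) ⟫ p ≡ (if does d then coeff p m else 0ℤ)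
      guard-outside (yes _) = sym (coeff≡⟪atMono⟫ p m)
      guard-outside (no  _) = ∑-zero p (λ t → ℤP.*-zeroʳ (proj₁ t))

  -- Terms with monomials that are not good do not survive in p: the constant term
  -- vanishes by assumption, and p ∈ ℤ[E(v)].
  constant-free⇒IdealEv : ∀ p → InR G v p → coeff p zeros ≡ 0ℤ → IdealEv G v p
  constant-free⇒IdealEv p p∈R c₀≡0 = IdealEv-≋ (mk≋ {p = p} {q = filter goodTerm? p} (λ m → sym (trans (coeff-filter-good p m) (only-good m (good? m)))))
                                                (IdealEv-filter-good p)
    where
    only-good : ∀ m (d : Dec (Good m)) → (if does d then coeff p m else 0ℤ) ≡ coeff p m
    only-good m (yes _) = refl
    only-good m (no bad) with m ≟M zeros
    ... | yes refl = sym c₀≡0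
    ... | no  m≢0 with coeff p m ℤ.≟ 0ℤ
    ...   | yes c≡0 = sym c≡0
    ...   | no  c≢0 = ⊥-elim (bad (m≢0 , λ i → map₂ (p∈R m c≢0 i) (toSum (Inc? i))))

-- A cycle through v avoiding S, or a relation reducing an edge at v to S

module CycleOrCut (G : Digraph) (v : Fin (nV G)) where

  private
    E = Fin (nE G)

  CycleAvoiding : List E → Set
  CycleAvoiding S = Σ (Cycle G) (λ C → Through G v C × (∀ e′ → Uses G C e′ → e′ ∉ S))

  ReducesTo : List E → E → Set
  ReducesTo S e = Σ (E → ℤ) (λ κ → (∀ e′ → e′ ∉ S → κ e′ ≡ 0ℤ) × var e -P linForm κ ∈⟨ ΔG G ⟩)

  private
    Allowed : List E → E → E → Set
    Allowed S e e′ = e′ ∉ S × e′ ≢ e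

    allowed? : ∀ S e e′ → Dec (Allowed S e e′)
    allowed? S e e′ = ¬? (DecMem._∈?_ _≟F_ e′ S) ×-dec ¬? (e′ ≟F e)

  -- Let u be the other end of e. If u reaches v avoiding S and e, e closes a cycle; otherwise
  -- the vertices reaching v form a cut which e crosses and no allowed edge crosses.
  module _ (S : List E) (e : E) (e∉S : e ∉ S) where
    open Reachability G v (allowed? S e)

    cycle-or-reduction : ∀ u → Joins G e v u → CycleAvoiding S ⊎ ReducesTo S e
    cycle-or-reduction u J with reachable? u
    ... | yes u-reaches = let (P , _) = reach⇒path (nV G) u u-reaches
                              open ClosePath P e J (λ i → proj₂ (Path.allowed P i))
                          in inj₁ (cycle , through , λ e′ used → avoids P e′ (uses e′ used))
      where
      avoids : ∀ {w} (P : Path w) e′ → e′ ≡ e ⊎ Σ (Fin (Path.k P)) (λ j → Path.ys P j ≡ e′) → e′ ∉ S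
      avoids P e′ (inj₁ refl)       = e∉S
      avoids P e′ (inj₂ (j , refl)) = proj₁ (Path.allowed P j)
    ... | no u-isolated = inj₂ (κ , κ-on-S , ∈⟨⟩-resp-≋ (var-reduction e s c) (∈⟨⟩-*Pˡ (constP s) (cut∈⟨Δ⟩ G reachable?)))
      where
      c = crossing G reachable?
      s = c e
      κ : E → ℤ
      κ e′ = kronecker e e′ 1ℤ - s * c e′
      uncrossed : ∀ e′ → Allowed S e e′ → c e′ ≡ 0ℤ
      uncrossed e′ a with reachable? (src G e′) | reachable? (tgt G e′)
      ... | yes _  | yes _  = refl
      ... | no  _  | no  _  = refl
      ... | yes rs | no ¬rt = ⊥-elim (¬rt (reachable-step e′ a (inj₂ (refl , refl)) rs))
      ... | no ¬rs | yes rt = ⊥-elim (¬rs (reachable-step e′ a (inj₁ (refl , refl)) rt))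
      s²≡1 : Joins G e v u → s * s ≡ 1ℤ
      s²≡1 (inj₁ (s≡v , t≡u)) = cong (λ z → z * z)
        (cong₂ _-_ (χ-yes (reachable? (src G e)) (subst Reachable (sym s≡v) reachable-v))
                   (χ-no  (reachable? (tgt G e)) (u-isolated ∘ subst Reachable t≡u)))
      s²≡1 (inj₂ (s≡u , t≡v)) = cong (λ z → z * z)
        (cong₂ _-_ (χ-no  (reachable? (src G e)) (u-isolated ∘ subst Reachable s≡u))
                   (χ-yes (reachable? (tgt G e)) (subst Reachable (sym t≡v) reachable-v)))
      κ-on-S : ∀ e′ → e′ ∉ S → κ e′ ≡ 0ℤ
      κ-on-S e′ e′∉S with e ≟F e′
      ... | yes refl = trans (cong (λ z → 1ℤ - z) (s²≡1 J)) (ℤP.+-inverseʳ 1ℤ)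
      ... | no  e≢e′ = trans (cong (λ z → 0ℤ - s * z) (uncrossed e′ (e′∉S , e≢e′ ∘ sym)))
                         (trans (ℤP.+-identityˡ (- (s * 0ℤ))) (cong -_ (ℤP.*-zeroʳ s)))

  private
    var-minusP-linForm-kronecker : ∀ e → var e -P linForm (λ e′ → kronecker e e′ 1ℤ) ≋ 0P
    var-minusP-linForm-kronecker e = ≋-ext (λ g → begin
      ⟪ g ⟫ (var e -P linForm (λ e′ → kronecker e e′ 1ℤ))
        ≡⟨ trans (⟪⟫-minusP g (var e) (linForm (λ e′ → kronecker e e′ 1ℤ))) (cong (λ x → ⟪ g ⟫ (var e) - x) (⟪⟫-linForm g (λ e′ → kronecker e e′ 1ℤ))) ⟩
      ⟪ g ⟫ (var e) - ∑ (λ e′ → kronecker e e′ 1ℤ * ⟪ g ⟫ (var e′)) (allFin (nE G))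
        ≡⟨ cong (λ x → ⟪ g ⟫ (var e) - x) (trans (∑-cong (allFin (nE G)) (λ e′ → kronecker-1-* e e′ (⟪ g ⟫ (var e′)))) (∑-kronecker e (⟪ g ⟫ ∘ var))) ⟩
      ⟪ g ⟫ (var e) - ⟪ g ⟫ (var e)
        ≡⟨ ℤP.+-inverseʳ (⟪ g ⟫ (var e)) ⟩
      0ℤ ∎)
      where open ≡-Reasoning

  cycle-or-reduction-at-v : ∀ S e → Inc G v e → CycleAvoiding S ⊎ ReducesTo S e
  cycle-or-reduction-at-v S e e-at-v with DecMem._∈?_ _≟F_ e S
  ... | yes e∈S = inj₂ (κ , κ-on-S , ∈⟨⟩-resp-≋ (var-minusP-linForm-kronecker e) ∈⟨⟩-0P)
    where
    κ : E → ℤ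
    κ e′ = kronecker e e′ 1ℤ
    κ-on-S : ∀ e′ → e′ ∉ S → κ e′ ≡ 0ℤ
    κ-on-S e′ e′∉S with e ≟F e′
    ... | yes refl = ⊥-elim (e′∉S e∈S)
    ... | no  _    = refl
  ... | no e∉S with e-at-v
  ...   | inj₁ s≡v = cycle-or-reduction S e e∉S (tgt G e) (inj₁ (s≡v , refl))
  ...   | inj₂ t≡v = cycle-or-reduction S e e∉S (src G e) (inj₂ (refl , t≡v))

  cycle-or-vars∈⟨Δ⟩ : HasCycleThrough G v ⊎ (∀ e → Inc G v e → var e ∈⟨ ΔG G ⟩)
  cycle-or-vars∈⟨Δ⟩ = map₂ (λ all∈ e e-at-v → all∈ e (MemP.∈-allFin e) e-at-v) (over (allFin (nE G)))
    where
    var∈⟨Δ⟩ : ∀ e → ReducesTo [] e → var e ∈⟨ ΔG G ⟩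
    var∈⟨Δ⟩ e (κ , κ≡0 , reduced) = ∈⟨⟩-resp-≋ (≋-ext (λ g → sym (begin
      ⟪ g ⟫ (var e -P linForm κ)                        ≡⟨ trans (⟪⟫-minusP g (var e) (linForm κ)) (cong (λ x → ⟪ g ⟫ (var e) - x) (⟪⟫-linForm g κ)) ⟩
      ⟪ g ⟫ (var e) - ∑ (λ e′ → κ e′ * ⟪ g ⟫ (var e′)) Es ≡⟨ cong (λ x → ⟪ g ⟫ (var e) - x) (∑-zero Es (λ e′ → trans (cong (_* ⟪ g ⟫ (var e′)) (κ≡0 e′ (λ ()))) (ℤP.*-zeroˡ (⟪ g ⟫ (var e′))))) ⟩
      ⟪ g ⟫ (var e) - 0ℤ                                ≡⟨ ℤP.+-identityʳ _ ⟩
      ⟪ g ⟫ (var e) ∎))) reduced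
      where open ≡-Reasoning
            Es = allFin (nE G)
    over : ∀ es → HasCycleThrough G v ⊎ (∀ e → e ∈ es → Inc G v e → var e ∈⟨ ΔG G ⟩)
    over []       = inj₂ (λ _ ())
    over (e ∷ es) with over es | AtVertex.Inc? G v e
    ... | inj₁ cyc   | _         = inj₁ cyc
    ... | inj₂ rest  | no  e-off = inj₂ (λ { _ (here refl) e-at → ⊥-elim (e-off e-at) ; e′ (there e′∈) → rest e′ e′∈ })
    ... | inj₂ rest  | yes e-at  with cycle-or-reduction-at-v [] e e-at
    ...   | inj₁ (C , through , _) = inj₁ (C , through)
    ...   | inj₂ red               = inj₂ (λ { _ (here refl) _ → var∈⟨Δ⟩ e red ; e′ (there e′∈) → rest e′ e′∈ })

-- More integer vectors than coordinates are linearly dependent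

module Dependency {X : Set} (_≟X_ : (x y : X) → Dec (x ≡ y)) where

  Dependent : (r : ℕ) → (Fin r → X → ℤ) → Set
  Dependent r b = Σ (Fin r → ℤ) (λ c → (Σ (Fin r) λ i → c i ≢ 0ℤ) × (∀ x → ∑ (λ i → c i * b i x) (allFin r) ≡ 0ℤ))

  module Eliminate {r} (t : X) (b : Fin (suc r) → X → ℤ) (i₀ : Fin (suc r)) (pivot≢0 : b i₀ t ≢ 0ℤ) where

    private
      a = b i₀ t
      bₖ : Fin r → X → ℤ
      bₖ k = b (punchIn i₀ k)

    eliminated : Fin r → X → ℤ
    eliminated k x = a * bₖ k x - bₖ k t * b i₀ x

    eliminated-t : ∀ k → eliminated k t ≡ 0ℤ
    eliminated-t k = comm a (bₖ k t)
      where comm : ∀ x y → x * y - y * x ≡ 0ℤ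
            comm = solve-∀

    eliminated-0 : ∀ k x → bₖ k x ≡ 0ℤ → b i₀ x ≡ 0ℤ → eliminated k x ≡ 0ℤ
    eliminated-0 k x bₖₓ≡0 bᵢ₀ₓ≡0 = trans (cong₂ (λ y z → a * y - bₖ k t * z) bₖₓ≡0 bᵢ₀ₓ≡0) (zeros a (bₖ k t))
      where zeros : ∀ x y → x * 0ℤ - y * 0ℤ ≡ 0ℤ
            zeros = solve-∀

    -- A relation ∑ dₖ eliminatedₖ = 0 is the relation ∑ (a dₖ) bₖ - (∑ dₖ bₖ(t)) bᵢ₀ = 0.
    module _ (d : Fin r → ℤ) where

      private
        S = ∑ (λ k → d k * bₖ k t) (allFin r)

      lifted : Fin (suc r) → ℤ
      lifted i with i₀ ≟F i
      ... | yes _    = - S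
      ... | no  i₀≢i = a * d (punchOut i₀≢i)

      lifted-i₀ : lifted i₀ ≡ - S
      lifted-i₀ with i₀ ≟F i₀
      ... | yes _ = refl
      ... | no  ≢ = ⊥-elim (≢ refl)

      lifted-punchIn : ∀ k → lifted (punchIn i₀ k) ≡ a * d k
      lifted-punchIn k with i₀ ≟F punchIn i₀ k
      ... | yes eq = ⊥-elim (FP.punchInᵢ≢i i₀ k (sym eq))
      ... | no  _  = cong (λ z → a * d z) (trans (FP.punchOut-cong i₀ refl) (FP.punchOut-punchIn i₀))

      ∑-lifted : ∀ x → ∑ (λ i → lifted i * b i x) (allFin (suc r)) ≡ ∑ (λ k → d k * eliminated k x) (allFin r)
      ∑-lifted x = begin
        ∑ (λ i → lifted i * b i x) (allFin (suc r))
          ≡⟨ ∑-punchIn i₀ (λ i → lifted i * b i x) ⟩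
        lifted i₀ * b i₀ x + ∑ (λ k → lifted (punchIn i₀ k) * bₖ k x) (allFin r)
          ≡⟨ cong₂ _+_ (cong (_* b i₀ x) lifted-i₀)
                       (∑-cong (allFin r) (λ k → trans (cong (_* bₖ k x) (lifted-punchIn k)) (ℤP.*-assoc a (d k) (bₖ k x)))) ⟩
        - S * b i₀ x + ∑ (λ k → a * (d k * bₖ k x)) (allFin r)
          ≡⟨ cong (- S * b i₀ x +_) (∑-*ˡ a (λ k → d k * bₖ k x) (allFin r)) ⟩
        - S * b i₀ x + a * ∑ (λ k → d k * bₖ k x) (allFin r)
          ≡⟨ reorder S (b i₀ x) a _ ⟩
        a * ∑ (λ k → d k * bₖ k x) (allFin r) - S * b i₀ x
          ≡⟨ sym (cong₂ _-_ (∑-*ˡ a (λ k → d k * bₖ k x) (allFin r)) (∑-*ʳ (b i₀ x) (λ k → d k * bₖ k t) (allFin r))) ⟩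
        ∑ (λ k → a * (d k * bₖ k x)) (allFin r) - ∑ (λ k → d k * bₖ k t * b i₀ x) (allFin r)
          ≡⟨ sym (∑-minus (λ k → a * (d k * bₖ k x)) (λ k → d k * bₖ k t * b i₀ x) (allFin r)) ⟩
        ∑ (λ k → a * (d k * bₖ k x) - d k * bₖ k t * b i₀ x) (allFin r)
          ≡⟨ ∑-cong (allFin r) (λ k → sym (expand (d k) (bₖ k x) (bₖ k t) a (b i₀ x))) ⟩
        ∑ (λ k → d k * eliminated k x) (allFin r) ∎
        where
        open ≡-Reasoning
        reorder : ∀ S y a T → - S * y + a * T ≡ a * T - S * y
        reorder = solve-∀
        expand : ∀ dₖ u v a z → dₖ * (a * u - v * z) ≡ a * (dₖ * u) - dₖ * v * z
        expand = solve-∀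

    lift : Dependent r eliminated → Dependent (suc r) b
    lift (d , (k , dₖ≢0) , ∑d·elim≡0) = lifted d , (punchIn i₀ k , lifted≢0) , λ x → trans (∑-lifted d x) (∑d·elim≡0 x)
      where lifted≢0 : lifted d (punchIn i₀ k) ≢ 0ℤ
            lifted≢0 l≡0 = [ pivot≢0 , dₖ≢0 ]′ (ℤP.i*j≡0⇒i≡0∨j≡0 a (trans (sym (lifted-punchIn d k)) l≡0))

  dependent : ∀ (T : List X) r → length T < r → (b : Fin r → X → ℤ) →
              (∀ i x → x ∉ T → b i x ≡ 0ℤ) → Dependent r b
  dependent []      (suc r) _          b b-on-T = (λ _ → 1ℤ) , (fzero , λ ()) ,
    λ x → ∑-zero (allFin (suc r)) (λ i → trans (ℤP.*-identityˡ _) (b-on-T i x (λ ())))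
  dependent (t ∷ T) (suc r) (s≤s |T|<r) b b-on-T with FP.any? (λ i → ¬? (b i t ℤ.≟ 0ℤ))
  ... | yes (i₀ , pivot≢0) = lift (dependent T r |T|<r eliminated elim-on-T)
    where
    open Eliminate t b i₀ pivot≢0
    elim-on-T : ∀ k x → x ∉ T → eliminated k x ≡ 0ℤ
    elim-on-T k x x∉T with x ≟X t
    ... | yes refl = eliminated-t k
    ... | no  x≢t  = eliminated-0 k x (b-on-T _ x x∉t∷T) (b-on-T i₀ x x∉t∷T)
      where x∉t∷T : x ∉ t ∷ T
            x∉t∷T (here x≡t)  = x≢t x≡t
            x∉t∷T (there x∈T) = x∉T x∈T
  ... | no  t-unused = dependent T (suc r) (ℕP.m≤n⇒m≤1+n |T|<r) b b-on-T′
    where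
    b-on-T′ : ∀ i x → x ∉ T → b i x ≡ 0ℤ
    b-on-T′ i x x∉T with x ≟X t
    ... | yes refl = decidable-stable (b i x ℤ.≟ 0ℤ) (λ bᵢₓ≢0 → t-unused (i , bᵢₓ≢0))
    ... | no  x≢t  = b-on-T i x λ { (here x≡t) → x≢t x≡t ; (there x∈T) → x∉T x∈T }

module _ {n : ℕ} where

  combination : ∀ {k} → (Fin k → ℤ) → (Fin k → Poly n) → Poly n
  combination {k} c ps = sumP (map (λ i → constP (c i) *P ps i) (allFin k))

  ⟪⟫-combination : ∀ (g : Mono n → ℤ) {k} (c : Fin k → ℤ) ps → ⟪ g ⟫ (combination c ps) ≡ ∑ (λ i → c i * ⟪ g ⟫ (ps i)) (allFin k)
  ⟪⟫-combination g {k} c ps = trans (⟪⟫-sumP g (map (λ i → constP (c i) *P ps i) (allFin k)))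
    (trans (∑-map ⟪ g ⟫ (λ i → constP (c i) *P ps i) (allFin k)) (∑-cong (allFin k) (λ i → ⟪⟫-constP* g (c i) (ps i))))

  combination-∈⟨⟩ : ∀ {rs : List (Poly n)} {k} (c : Fin k → ℤ) ps → (∀ i → c i ≡ 0ℤ ⊎ ps i ∈⟨ rs ⟩) → combination c ps ∈⟨ rs ⟩
  combination-∈⟨⟩ {k = k} c ps terms∈ = ∈⟨⟩-sumP (λ i → constP (c i) *P ps i) (allFin k) (λ i _ → term∈ i (terms∈ i))
    where
    term∈ : ∀ i → c i ≡ 0ℤ ⊎ ps i ∈⟨ _ ⟩ → constP (c i) *P ps i ∈⟨ _ ⟩
    term∈ i (inj₂ pᵢ∈) = ∈⟨⟩-*Pˡ (constP (c i)) pᵢ∈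
    term∈ i (inj₁ cᵢ≡0) = ∈⟨⟩-resp-≋ (≋-ext (λ g → trans (⟪⟫-constP* g (c i) (ps i))
                            (trans (cong (_* ⟪ g ⟫ (ps i)) cᵢ≡0) (ℤP.*-zeroˡ (⟪ g ⟫ (ps i)))))) ∈⟨⟩-0P

  InVars-combination : ∀ (S : Fin n → Set) {k} (c : Fin k → ℤ) ps → (∀ i → InVars S (ps i)) → InVars S (combination c ps)
  InVars-combination S {k} c ps ps∈ = go (allFin k)
    where go : ∀ is → InVars S (sumP (map (λ i → constP (c i) *P ps i) is))
          go []       = InVars-0P S
          go (i ∷ is) = InVars-+P S (constP (c i) *P ps i) (sumP (map (λ i → constP (c i) *P ps i) is)) (InVars-*P S (constP (c i)) (ps i) (InVars-constP S (c i)) (ps∈ i)) (go is)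

  linForm-substitute : ∀ {rs : List (Poly n)} (a : Fin n → ℤ) (κ : Fin n → Fin n → ℤ) →
    (∀ e → a e ≡ 0ℤ ⊎ var e -P linForm (κ e) ∈⟨ rs ⟩) →
    linForm a -P linForm (λ e′ → ∑ (λ e → a e * κ e e′) (allFin n)) ∈⟨ rs ⟩
  linForm-substitute a κ reduces = ∈⟨⟩-resp-≋ (≋-ext ⟪⟫-lhs≡) (combination-∈⟨⟩ a (λ e → var e -P linForm (κ e)) reduces)
    where
    Es = allFin n
    b : Fin n → ℤ
    b e′ = ∑ (λ e → a e * κ e e′) Es
    ⟪⟫-lhs≡ : ∀ g → ⟪ g ⟫ (linForm a -P linForm b) ≡ ⟪ g ⟫ (combination a (λ e → var e -P linForm (κ e)))
    ⟪⟫-lhs≡ g = begin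
      ⟪ g ⟫ (linForm a -P linForm b)
        ≡⟨ trans (⟪⟫-minusP g (linForm a) (linForm b)) (cong₂ _-_ (⟪⟫-linForm g a) (⟪⟫-linForm g b)) ⟩
      ∑ (λ e → a e * x e) Es - ∑ (λ e′ → ∑ (λ e → a e * κ e e′) Es * x e′) Es
        ≡⟨ cong (λ z → ∑ (λ e → a e * x e) Es - z) regroup ⟩
      ∑ (λ e → a e * x e) Es - ∑ (λ e → a e * ∑ (λ e′ → κ e e′ * x e′) Es) Es
        ≡⟨ sym (trans (∑-cong Es (λ e → *-distribˡ-minus (a e) (x e) (∑ (λ e′ → κ e e′ * x e′) Es)))
                      (∑-minus (λ e → a e * x e) (λ e → a e * ∑ (λ e′ → κ e e′ * x e′) Es) Es)) ⟩
      ∑ (λ e → a e * (x e - ∑ (λ e′ → κ e e′ * x e′) Es)) Es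
        ≡⟨ ∑-cong Es (λ e → cong (a e *_) (sym (trans (⟪⟫-minusP g (var e) (linForm (κ e))) (cong (λ z → x e - z) (⟪⟫-linForm g (κ e)))))) ⟩
      ∑ (λ e → a e * ⟪ g ⟫ (var e -P linForm (κ e))) Es
        ≡⟨ sym (⟪⟫-combination g a (λ e → var e -P linForm (κ e))) ⟩
      ⟪ g ⟫ (combination a (λ e → var e -P linForm (κ e))) ∎
      where
      open ≡-Reasoning
      x : Fin n → ℤ
      x e = ⟪ g ⟫ (var e)
      regroup : ∑ (λ e′ → ∑ (λ e → a e * κ e e′) Es * x e′) Es ≡ ∑ (λ e → a e * ∑ (λ e′ → κ e e′ * x e′) Es) Es
      regroup = begin
        ∑ (λ e′ → ∑ (λ e → a e * κ e e′) Es * x e′) Es        ≡⟨ ∑-cong Es (λ e′ → sym (∑-*ʳ (x e′) (λ e → a e * κ e e′) Es)) ⟩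
        ∑ (λ e′ → ∑ (λ e → a e * κ e e′ * x e′) Es) Es        ≡⟨ ∑-swap (λ e′ e → a e * κ e e′ * x e′) Es Es ⟩
        ∑ (λ e → ∑ (λ e′ → a e * κ e e′ * x e′) Es) Es        ≡⟨ ∑-cong Es (λ e → trans (∑-cong Es (λ e′ → ℤP.*-assoc (a e) (κ e e′) (x e′))) (∑-*ˡ (a e) (λ e′ → κ e e′ * x e′) Es)) ⟩
        ∑ (λ e → a e * ∑ (λ e′ → κ e e′ * x e′) Es) Es        ∎

  combination-linForm≋0 : ∀ {k} (c : Fin k → ℤ) (B : Fin k → Fin n → ℤ) →
    (∀ e → ∑ (λ i → c i * B i e) (allFin k) ≡ 0ℤ) → combination c (linForm ∘ B) ≋ 0P
  combination-linForm≋0 {k} c B ∑cB≡0 = ≋-ext (λ g → let x = λ e → ⟪ g ⟫ (var e) in begin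
    ⟪ g ⟫ (combination c (linForm ∘ B))
      ≡⟨ ⟪⟫-combination g c (linForm ∘ B) ⟩
    ∑ (λ i → c i * ⟪ g ⟫ (linForm (B i))) Is
      ≡⟨ ∑-cong Is (λ i → trans (cong (c i *_) (⟪⟫-linForm g (B i))) (sym (∑-*ˡ (c i) (λ e → B i e * x e) Es))) ⟩
    ∑ (λ i → ∑ (λ e → c i * (B i e * x e)) Es) Is
      ≡⟨ ∑-swap (λ i e → c i * (B i e * x e)) Is Es ⟩
    ∑ (λ e → ∑ (λ i → c i * (B i e * x e)) Is) Es
      ≡⟨ ∑-cong Es (λ e → trans (∑-cong Is (λ i → sym (ℤP.*-assoc (c i) (B i e) (x e)))) (∑-*ʳ (x e) (λ i → c i * B i e) Is)) ⟩
    ∑ (λ e → ∑ (λ i → c i * B i e) Is * x e) Es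
      ≡⟨ ∑-zero Es (λ e → trans (cong (_* x e) (∑cB≡0 e)) (ℤP.*-zeroˡ (x e))) ⟩
    0ℤ ∎)
    where
    open ≡-Reasoning
    Is = allFin k
    Es = allFin n

  combination-modulo : ∀ {rs : List (Poly n)} {k} (c : Fin k → ℤ) ps qs → combination c qs ≋ 0P →
    combination c (λ i → ps i -P qs i) ∈⟨ rs ⟩ → combination c ps ∈⟨ rs ⟩
  combination-modulo {k = k} c ps qs qs≋0 = ∈⟨⟩-resp-≋ (≋-ext same)
    where
    same : ∀ g → ⟪ g ⟫ (combination c ps) ≡ ⟪ g ⟫ (combination c (λ i → ps i -P qs i))
    same g = begin
      ⟪ g ⟫ (combination c ps)
        ≡⟨ trans (⟪⟫-combination g c ps) (sym (ℤP.+-identityʳ _)) ⟩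
      ∑ (λ i → c i * ⟪ g ⟫ (ps i)) Is - 0ℤ
        ≡⟨ cong (λ z → ∑ (λ i → c i * ⟪ g ⟫ (ps i)) Is - z)
             (sym (trans (sym (⟪⟫-combination g c qs)) (⟪⟫-resp-≋ g qs≋0))) ⟩
      ∑ (λ i → c i * ⟪ g ⟫ (ps i)) Is - ∑ (λ i → c i * ⟪ g ⟫ (qs i)) Is
        ≡⟨ sym (∑-minus (λ i → c i * ⟪ g ⟫ (ps i)) (λ i → c i * ⟪ g ⟫ (qs i)) Is) ⟩
      ∑ (λ i → c i * ⟪ g ⟫ (ps i) - c i * ⟪ g ⟫ (qs i)) Is
        ≡⟨ ∑-cong Is (λ i → sym (trans (cong (c i *_) (⟪⟫-minusP g (ps i) (qs i))) (*-distribˡ-minus (c i) _ _))) ⟩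
      ∑ (λ i → c i * ⟪ g ⟫ (ps i -P qs i)) Is
        ≡⟨ sym (⟪⟫-combination g c (λ i → ps i -P qs i)) ⟩
      ⟪ g ⟫ (combination c (λ i → ps i -P qs i)) ∎
      where
      open ≡-Reasoning
      Is = allFin k

module Annihilator (G : Digraph) (v : Fin (nV G)) where
  open AtVertex G v
  open CycleOrCut G v

  private
    zeros = Vec.replicate (nE G) 0

  ann⇒∈⟨Δ⟩ : ∀ a → Ann G v a → a ∈⟨ ΔG G ⟩
  ann⇒∈⟨Δ⟩ a (_ , a*h∈) = ∈⟨⟩-resp-≋ (≋-sym (*P-identityʳ a)) (mk∈⟨⟩ (a*h∈ 1P))

  ∈⟨Δ⟩⇒ann : ∀ {a} → InR G v a → a ∈⟨ ΔG G ⟩ → Ann G v a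
  ∈⟨Δ⟩⇒ann a∈R a∈ = a∈R , λ h → _∈⟨_⟩.membership (∈⟨⟩-*P h a∈)

  ann-flow-free : ∀ {f} → Circulation G f → ∀ a → Ann G v a → ⟪ linTerm f ⟫ a ≡ 0ℤ
  ann-flow-free circ a ann = proj₂ (circulation-kills-⟨Δ⟩ G circ (ann⇒∈⟨Δ⟩ a ann))

  ann-constant-free : ∀ a → Ann G v a → coeff a zeros ≡ 0ℤ
  ann-constant-free a ann = trans (coeff-0≡ev₀ a) (proj₁ (circulation-kills-⟨Δ⟩ G zero-circulation (ann⇒∈⟨Δ⟩ a ann)))
    where zero-circulation : Circulation G (λ _ → 0ℤ)
          zero-circulation w = trans (∑-zero (outE G w) (λ _ → refl)) (sym (∑-zero (inE G w) (λ _ → refl)))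

  homog₁-var : ∀ e → Homog 1 (var {nE G} e)
  homog₁-var e m c≢0 = trans (cong degM (sym (coeff-single 1ℤ (unitM e) m c≢0))) (degM-unitM e)

  homog₁∈⟨Δ⟩ : (∀ e → Inc G v e → var e ∈⟨ ΔG G ⟩) → ∀ p → InR G v p → Homog 1 p → p ∈⟨ ΔG G ⟩
  homog₁∈⟨Δ⟩ vars∈ p p∈R hom = ∈⟨⟩-resp-≋ (homog₁≋linForm p hom) (combination-∈⟨⟩ (λ e → coeff p (unitM e)) var term∈)
    where term∈ : ∀ e → coeff p (unitM e) ≡ 0ℤ ⊎ var e ∈⟨ ΔG G ⟩
          term∈ e with Inc? e
          ... | yes e-at = inj₂ (vars∈ e e-at)
          ... | no  e-off = inj₁ (InR-homog₁-coeff p p∈R e e-off)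

  module CycleEdgeAtV (C : Cycle G) (through : Through G v C) where
    open Cycle C
    open CycleCirculation G C

    edge : Fin (nE G)
    edge = xs (proj₁ through)

    edge-at-v : Inc G v edge
    edge-at-v with joins (proj₁ through)
    ... | inj₁ (s , _) = inj₁ (trans s (proj₂ through))
    ... | inj₂ (_ , t) = inj₂ (trans t (proj₂ through))

    flow-edge : ⟪ linTerm flow ⟫ (var edge) ≡ orient (proj₁ through)
    flow-edge = trans (DualEvaluation.ev₁-var flow edge) (flow-on-cycle (proj₁ through))

    edge∉ann : ¬ Ann G v (var edge)
    edge∉ann ann = orient≢0 (proj₁ through) (trans (sym flow-edge) (ann-flow-free flow-circulation (var edge) ann))

    edge∈A₁ : InA1 G v (var edge)
    edge∈A₁ = InR-var edge edge-at-v , homog₁-var edge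

  cycle⇒A₁≢0 : HasCycleThrough G v → A1NonZero G v
  cycle⇒A₁≢0 (C , through) = var edge , proj₁ edge∈A₁ , proj₂ edge∈A₁ , edge∉ann
    where open CycleEdgeAtV C through

  A₁≢0⇒cycle : A1NonZero G v → HasCycleThrough G v
  A₁≢0⇒cycle (p , p∈R , hom , p∉ann) with cycle-or-vars∈⟨Δ⟩
  ... | inj₁ cycle = cycle
  ... | inj₂ vars∈ = ⊥-elim (p∉ann (∈⟨Δ⟩⇒ann p∈R (homog₁∈⟨Δ⟩ vars∈ p p∈R hom)))

  private
    IdealEv-minusP-self : ∀ p → IdealEv G v (p -P p)
    IdealEv-minusP-self p = IdealEv-≋ (-P-self p) IdealEv-0P

  -- Without cycles, ann = (E(v)): the identity is the isomorphism.
  acyclic⇒A≅ℤ : ¬ HasCycleThrough G v → AIsoZ G v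
  acyclic⇒A≅ℤ acyclic = record
    { f       = λ p → p
    ; f-R     = λ p p∈R → p∈R
    ; f-resp  = λ p q p∈R q∈R ann → constant-free⇒IdealEv (p -P q) (InVars-minusP (Inc G v) p q p∈R q∈R) (ann-constant-free (p -P q) ann)
    ; f-add   = λ p q _ _ → IdealEv-minusP-self (p +P q)
    ; f-lin   = λ a p _ _ → IdealEv-minusP-self (a *P p)
    ; f-grade = λ d p p∈R hom → p , p∈R , hom , IdealEv-minusP-self p
    ; f-inj   = λ p q p∈R q∈R ideal → ∈⟨Δ⟩⇒ann (InVars-minusP (Inc G v) p q p∈R q∈R) (IdealEv⇒∈⟨Δ⟩ {p -P q} ideal vars∈)
    ; f-surj  = λ q q∈R → q , q∈R , IdealEv-minusP-self q
    }
    where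
    vars∈ : ∀ e → Inc G v e → var e ∈⟨ ΔG G ⟩
    vars∈ with cycle-or-vars∈⟨Δ⟩
    ... | inj₁ cycle = ⊥-elim (acyclic cycle)
    ... | inj₂ vars∈ = vars∈

  -- An isomorphism sends the degree-one class of the cycle edge x into (E(v)), and so
  -- does it with 0; injectivity then puts x in ann.
  A≅ℤ⇒acyclic : AIsoZ G v → ¬ HasCycleThrough G v
  A≅ℤ⇒acyclic iso (C , through) = edge∉ann (f-inj (var edge) 0P x∈R (InVars-0P (Inc G v)) fx-f0∈)
    where
    open CycleEdgeAtV C through
    open GradedIso iso
    x∈R = InR-var edge edge-at-v
    fx∈ : IdealEv G v (f (var edge))
    fx∈ with f-grade 1 (var edge) x∈R (homog₁-var edge)
    ... | q , q∈R , hom , fx-q∈ =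
      IdealEv-≋ {f (var edge)} {(f (var edge) -P q) +P q} (≋-ext (λ g → sym (trans (⟪⟫-+P g (f (var edge) -P q) q) (trans (cong (_+ ⟪ g ⟫ q) (⟪⟫-minusP g (f (var edge)) q)) (cancel (⟪ g ⟫ (f (var edge))) (⟪ g ⟫ q))))))
        (IdealEv-+P {f (var edge) -P q} fx-q∈ (constant-free⇒IdealEv q q∈R (q-constant-free q hom)))
      where
      cancel : ∀ a b → a - b + b ≡ a
      cancel = solve-∀
      q-constant-free : ∀ q → Homog 1 q → coeff q zeros ≡ 0ℤ
      q-constant-free q hom = decidable-stable (coeff q zeros ℤ.≟ 0ℤ) (λ c≢0 → degM≢1-zeros {nE G} (hom zeros c≢0))
    f0∈ : IdealEv G v (f 0P)
    f0∈ = IdealEv-≋ {f 0P} { -P (f 0P -P (f 0P +P f 0P)) } (≋-ext (λ g → sym (trans (⟪⟫-negP g (f 0P -P (f 0P +P f 0P)))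
            (trans (cong -_ (trans (⟪⟫-minusP g (f 0P) (f 0P +P f 0P)) (cong (λ z → ⟪ g ⟫ (f 0P) - z) (⟪⟫-+P g (f 0P) (f 0P)))))
              (double (⟪ g ⟫ (f 0P)))))))
            (IdealEv-negP {f 0P -P (f 0P +P f 0P)} (f-add 0P 0P (InVars-0P (Inc G v)) (InVars-0P (Inc G v))))
      where double : ∀ a → - (a - (a + a)) ≡ a
            double = solve-∀
    fx-f0∈ : IdealEv G v (f (var edge) -P f 0P)
    fx-f0∈ = IdealEv-+P {f (var edge)} fx∈ (IdealEv-negP {f 0P} f0∈)

  -- Flows of edge-disjoint cycles separate their edges at v.
  disjoint-cycle-edges-independent : ∀ {k} (cs : Fin k → Cycle G) (through : ∀ i → Through G v (cs i)) →
    (∀ i j → i ≢ j → ∀ e → ¬ (Uses G (cs i) e × Uses G (cs j) e)) →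
    Indep G v (λ i → var (CycleEdgeAtV.edge (cs i) (through i)))
  disjoint-cycle-edges-independent {k} cs through disjoint c ann i =
    [ (λ cᵢ≡0 → cᵢ≡0) , (λ oᵢ≡0 → ⊥-elim (orient≢0 _ oᵢ≡0)) ]′ (ℤP.i*j≡0⇒i≡0∨j≡0 (c i) cᵢoᵢ≡0)
    where
    open CycleCirculation G (cs i)
    x : Fin k → Fin (nE G)
    x j = CycleEdgeAtV.edge (cs j) (through j)
    picks-i : ∀ j → c j * ⟪ linTerm flow ⟫ (var (x j)) ≡ kronecker i j (c j * orient (proj₁ (through i)))
    picks-i j with i ≟F j
    ... | yes refl = cong (c i *_) (CycleEdgeAtV.flow-edge (cs i) (through i))
    ... | no  i≢j  = trans (cong (c j *_) (trans (DualEvaluation.ev₁-var flow (x j)) (flow-off-cycle (x j) x∉Cᵢ))) (ℤP.*-zeroʳ (c j))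
      where x∉Cᵢ : ∀ t → Cycle.xs (cs i) t ≢ x j
            x∉Cᵢ t xₜ≡ = disjoint i j i≢j (x j) ((t , xₜ≡) , (proj₁ (through j) , refl))
    cᵢoᵢ≡0 : c i * orient (proj₁ (through i)) ≡ 0ℤ
    cᵢoᵢ≡0 = begin
      c i * orient (proj₁ (through i))                                  ≡⟨ sym (∑-kronecker i (λ j → c j * orient (proj₁ (through i)))) ⟩
      ∑ (λ j → kronecker i j (c j * orient (proj₁ (through i)))) (allFin k) ≡⟨ sym (∑-cong (allFin k) picks-i) ⟩
      ∑ (λ j → c j * ⟪ linTerm flow ⟫ (var (x j))) (allFin k)           ≡⟨ sym (⟪⟫-combination (linTerm flow) c (var ∘ x)) ⟩
      ⟪ linTerm flow ⟫ (combination c (var ∘ x))                        ≡⟨ ann-flow-free flow-circulation (combination c (var ∘ x)) ann ⟩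
      0ℤ                                                                ∎
      where open ≡-Reasoning

  rank-≥-α : ∀ r → IsRankA1 G v r → αLe G v r
  rank-≥-α r (_ , maximal) k cs through disjoint with k ℕ.≤? r
  ... | yes k≤r = k≤r
  ... | no  k≰r = ⊥-elim (maximal (λ i → var (CycleEdgeAtV.edge (cs (ι i)) (through (ι i)))) (λ i → CycleEdgeAtV.edge∈A₁ (cs (ι i)) (through (ι i)))
                    (disjoint-cycle-edges-independent (cs ∘ ι) (through ∘ ι) (λ i j i≢j → disjoint (ι i) (ι j) (i≢j ∘ ι-injective))))
    where
    r<k = ℕP.≰⇒> k≰r
    ι : Fin (suc r) → Fin k
    ι i = inject≤ i r<k
    ι-injective : ∀ {i j} → ι i ≡ ι j → i ≡ j
    ι-injective {i} {j} eq = FP.toℕ-injective (trans (sym (FP.toℕ-inject≤ i r<k)) (trans (cong toℕ eq) (FP.toℕ-inject≤ j r<k)))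

  module _ (S : List (Fin (nE G))) where

    hitting-set-reduces : (∀ C → Through G v C → Σ (Fin (nE G)) (λ e → e ∈ S × Uses G C e)) →
                          ∀ e → Inc G v e → ReducesTo S e
    hitting-set-reduces hits e e-at-v with cycle-or-reduction-at-v S e e-at-v
    ... | inj₁ (C , through , avoids) = let (e′ , e′∈S , used) = hits C through in ⊥-elim (avoids e′ used e′∈S)
    ... | inj₂ reduction              = reduction

    A₁-reduces : (∀ e → Inc G v e → ReducesTo S e) → ∀ p → InA1 G v p →
                 Σ (Fin (nE G) → ℤ) (λ b → (∀ e′ → e′ ∉ S → b e′ ≡ 0ℤ) × p -P linForm b ∈⟨ ΔG G ⟩)
    A₁-reduces reduces p (p∈R , hom) = b , b-on-S ,
      ∈⟨⟩-resp-≋ (≋-ext (λ g → trans (⟪⟫-minusP g p (linForm b))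
                   (trans (cong (_- ⟪ g ⟫ (linForm b)) (⟪⟫-resp-≋ g (homog₁≋linForm p hom))) (sym (⟪⟫-minusP g (linForm a) (linForm b))))))
                 (linForm-substitute a κ substituted)
      where
      Es = allFin (nE G)
      κ : Fin (nE G) → Fin (nE G) → ℤ
      κ e with Inc? e
      ... | yes e-at-v = proj₁ (reduces e e-at-v)
      ... | no  _      = λ _ → 0ℤ
      κ-on-S : ∀ e e′ → e′ ∉ S → κ e e′ ≡ 0ℤ
      κ-on-S e e′ e′∉S with Inc? e
      ... | yes e-at-v = proj₁ (proj₂ (reduces e e-at-v)) e′ e′∉S
      ... | no  _      = refl
      a : Fin (nE G) → ℤ
      a e = coeff p (unitM e)
      substituted : ∀ e → a e ≡ 0ℤ ⊎ var e -P linForm (κ e) ∈⟨ ΔG G ⟩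
      substituted e with Inc? e
      ... | yes e-at-v = inj₂ (proj₂ (proj₂ (reduces e e-at-v)))
      ... | no  e-off  = inj₁ (InR-homog₁-coeff p p∈R e e-off)
      b : Fin (nE G) → ℤ
      b e′ = ∑ (λ e → a e * κ e e′) Es
      b-on-S : ∀ e′ → e′ ∉ S → b e′ ≡ 0ℤ
      b-on-S e′ e′∉S = ∑-zero Es (λ e → trans (cong (a e *_) (κ-on-S e e′ e′∉S)) (ℤP.*-zeroʳ (a e)))

  -- More than |S| classes of A₁(v) reduce to linear forms supported on S, hence are dependent.
  rank-≤-β : ∀ r → IsRankA1 G v r → βGe G v r
  rank-≤-β r ((ps , ps∈A₁ , independent) , _) S S-at-v hits with r ℕ.≤? length S
  ... | yes r≤|S| = r≤|S|
  ... | no  r≰|S| = ⊥-elim (cᵢ≢0 (independent c (∈⟨Δ⟩⇒ann (InVars-combination (Inc G v) c ps (proj₁ ∘ ps∈A₁)) combination∈) i))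
    where
    reduced = λ i → A₁-reduces S (hitting-set-reduces S hits) (ps i) (ps∈A₁ i)
    b = proj₁ ∘ reduced
    dependency = Dependency.dependent _≟F_ S r (ℕP.≰⇒> r≰|S|) b (proj₁ ∘ proj₂ ∘ reduced)
    c = proj₁ dependency
    i = proj₁ (proj₁ (proj₂ dependency))
    cᵢ≢0 = proj₂ (proj₁ (proj₂ dependency))
    combination∈ : combination c ps ∈⟨ ΔG G ⟩
    combination∈ = combination-modulo c ps (linForm ∘ b) (combination-linForm≋0 c b (proj₂ (proj₂ dependency)))
                     (combination-∈⟨⟩ c (λ i → ps i -P linForm (b i)) (inj₂ ∘ proj₂ ∘ proj₂ ∘ reduced))

theorem1p18 : (G : Digraph) (v : Fin (nV G)) →
    ((¬ HasCycleThrough G v) ⇔ AIsoZ G v) ×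
    (HasCycleThrough G v ⇔ A1NonZero G v) ×
    (∀ (r : ℕ) → IsRankA1 G v r → αLe G v r × βGe G v r)
theorem1p18 G v =
  mk⇔ acyclic⇒A≅ℤ A≅ℤ⇒acyclic ,
  mk⇔ cycle⇒A₁≢0 A₁≢0⇒cycle ,
  λ r rank → rank-≥-α r rank , rank-≤-β r rank
  where open Annihilator G v
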